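{- Let $M=(E,G)$ be an $I_5$-free, triangle-free and $C_5$-free binary matroid, and let $F$ be a flat of $G$ of dimension at least $3$ such that $M|F$ is an affine geometry. Suppose $M/F$ contains an induced $I_3$-restriction, represented by three non-empty cosets $A_1,A_2,A_3$ of $F$. Then either $M|\mathrm{cl}(F\cup A_i)$ is an affine geometry for some $i\in\{1,2,3\}$, or $M|\mathrm{cl}(F\cup A_1\cup A_2\cup A_3)$ is a doubled kite of order $\dim(F)-3$.
   Context: A (simple binary) matroid is a pair $M=(E,G)$ where $G$ is a finite binary projective geometry identified with $\mathbb{F}_2^n\setminus\{0\}$ and $E\subseteq G$; $n$ is its dimension. A flat is a set $F\subseteq G$ with $\langle F\rangle:=F\cup\{0\}$ a subspace; $\mathrm{cl}(X)$ is the smallest flat containing $X$; $M|F=(E\cap F,F)$ is an induced restriction; isomorphism is an isomorphism of geometries carrying ground set to ground set. $M$ is $N$-free if no induced restriction is isomorphic to $N$. A triangle is a 2-dimensional flat; triangle-free means $E$ contains no triangle. $I_n=(B,G)$ with $B$ a basis of an $n$-dimensional $G$. $C_5$ is the 4-dimensional matroid whose ground set consists of 5 points summing to zero. $M|F$ is an affine geometry if $E\cap F=F\setminus W$ for some hyperplane $W$ of $F$. A coset of $F$ is a set $x+\langle F\rangle$ with $x\notin F$; it is non-empty if it meets $E$. The contraction $M/F$ is $(E_F,F')$ where $F'$ is a flat complementary to $F$ and $E_F=\{x\in F': E\cap(x+\langle F\rangle)\ne\varnothing\}$; an induced restriction of $M/F$ thus corresponds to a set of non-empty cosets of $F$. Doubling: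 if $H$ is a hyperplane of $G$ and $a\in G\setminus H$ with $E=(E\cap H)\cup(a+(E\cap H))$, then $M$ is the doubling of $M|H$; $D(N)$ denotes the doubling of $N$ and $D^k(N)=D(D^{k-1}(N))$, $D^0(N)=N$. A kite is the 6-dimensional matroid with basis $x_1,\dots,x_6$ and ground set $\{x_1,\dots,x_6,x_1+x_2+x_3,x_2+x_3+x_4,x_1+x_3+x_5,x_1+x_2+x_6\}$. A doubled kite of order $k$ is $D^k(\text{kite})$, of dimension $k+6$. -}

module Defs where

open import Level using (0ℓ)
open import Data.Bool using (Bool; true; false; not; _∧_; _∨_; _xor_; if_then_else_; T)
open import Data.Nat using (ℕ; zero; suc; _+_)
open import Data.Vec using (Vec; []; _∷_; replicate; zipWith)
open import Data.Vec.Properties using (≡-dec)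
open import Data.List using (List; foldr)
open import Data.Bool.ListAction using (any)
import Data.List as L
open import Data.List.Relation.Unary.All using (All)
open import Data.Product using (Σ; _×_; _,_; ∃)
open import Data.Sum using (_⊎_)
open import Relation.Nullary using (¬_; does)
open import Relation.Unary using (Pred; _⊆_; _∪_)
open import Relation.Binary.PropositionalEquality using (_≡_; _≢_)
open import Function.Bundles using (_⇔_)
import Data.Bool.Properties as BP

-- Binary projective geometry of dimension n:  F₂ⁿ ∖ {0},  F₂ = Bool.

V : ℕ → Set
V n = Vec Bool n

0v : ∀ {n} → V n
0v = replicate _ false

infixl 6 _⊕_
_⊕_ : ∀ {n} → V n → V n → V n
_⊕_ = zipWith _xor_

lincomb : ∀ {n k} → Vec Bool k → Vec (V n) k → V n
lincomb []       []       = 0v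
lincomb (c ∷ cs) (b ∷ bs) = if c then b ⊕ lincomb cs bs else lincomb cs bs

LinInd : ∀ {n k} → Vec (V n) k → Set
LinInd b = ∀ c → lincomb c b ≡ 0v → c ≡ 0v

InSpan : ∀ {n k} → Vec (V n) k → V n → Set
InSpan b x = ∃ λ c → lincomb c b ≡ x

PointSet : ℕ → Set₁
PointSet n = Pred (V n) 0ℓ

⟨_⟩ : ∀ {n} → PointSet n → PointSet n
⟨ F ⟩ x = x ≡ 0v ⊎ F x

IsFlat : ∀ {n} → PointSet n → Set
IsFlat F = (∀ x → F x → x ≢ 0v) × (∀ x y → ⟨ F ⟩ x → ⟨ F ⟩ y → ⟨ F ⟩ (x ⊕ y))

Cl : ∀ {n} → PointSet n → PointSet n
Cl X x = x ≢ 0v × Σ (List (V _)) (λ xs → All X xs × foldr _⊕_ 0v xs ≡ x)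

IsBasis : ∀ {n k} → PointSet n → Vec (V n) k → Set
IsBasis F b = LinInd b × (∀ x → F x ⇔ (x ≢ 0v × InSpan b x))

HasDim : ∀ {n} → PointSet n → ℕ → Set
HasDim {n} F d = Σ (Vec (V n) d) (IsBasis F)

-- Matroids: M = (E, G) with G = F₂ⁿ∖{0}; E is given by its characteristic
-- function; only the value at nonzero vectors matters (E ⊆ G).

Matroid : ℕ → Set
Matroid n = V n → Bool

Gr : ∀ {n} → Matroid n → PointSet n
Gr M x = x ≢ 0v × M x ≡ true

-- M|F ≅ N : there is an isomorphism of geometries (a linear bijection
-- F₂ᵏ → ⟨F⟩, given by the image b of the standard basis) carrying the
-- ground set of N onto E ∩ F.
IsoRestr : ∀ {n k} → Matroid n → PointSet n → Matroid k → Set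
IsoRestr {n} {k} M F N =
  Σ (Vec (V n) k) λ b → IsBasis F b × (∀ c → c ≢ 0v → M (lincomb c b) ≡ N c)

Free : ∀ {n k} → Matroid n → Matroid k → Set₁
Free M N = ∀ F → IsFlat F → ¬ IsoRestr M F N

TriangleFree : ∀ {n} → Matroid n → Set₁
TriangleFree M = ∀ T → IsFlat T → HasDim T 2 → ¬ (T ⊆ Gr M)

IsHyperplaneOf : ∀ {n} → PointSet n → PointSet n → Set
IsHyperplaneOf W F = IsFlat W × W ⊆ F × Σ ℕ (λ d → HasDim F (suc d) × HasDim W d)

IsAffine : ∀ {n} → Matroid n → PointSet n → Set₁
IsAffine M F = Σ (PointSet _) λ W → IsHyperplaneOf W F ×
                 (∀ x → F x → (Gr M x ⇔ (¬ W x)))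

Coset : ∀ {n} → PointSet n → V n → PointSet n
Coset F a x = Σ (V _) λ f → ⟨ F ⟩ f × x ≡ a ⊕ f

NonEmptyCoset : ∀ {n} → Matroid n → PointSet n → V n → Set
NonEmptyCoset M F a = Σ (V _) λ x → Coset F a x × Gr M x

-- The cosets a₁+⟨F⟩,…,a_k+⟨F⟩ represent an induced restriction of M/F
-- isomorphic to N: the aᵢ are linearly independent modulo ⟨F⟩ (so they
-- are the points of a basis of a k-dimensional flat of the contraction),
-- and for each nonzero c, the coset (Σ cᵢaᵢ)+⟨F⟩ is non-empty iff c ∈ E(N).
ContrRestrIso : ∀ {n k} → Matroid n → PointSet n → Vec (V n) k → Matroid k → Set
ContrRestrIso M F a N =
  (∀ c → ⟨ F ⟩ (lincomb c a) → c ≡ 0v) ×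
  (∀ c → c ≢ 0v → (NonEmptyCoset M F (lincomb c a) ⇔ N c ≡ true))

isZero : ∀ {n} → V n → Bool
isZero []      = true
isZero (x ∷ v) = not x ∧ isZero v

isUnit : ∀ {n} → V n → Bool
isUnit []          = false
isUnit (true ∷ v)  = isZero v
isUnit (false ∷ v) = isUnit v

allOnes : ∀ {n} → V n → Bool
allOnes []      = true
allOnes (x ∷ v) = x ∧ allOnes v

I : (n : ℕ) → Matroid n
I n = isUnit

C5 : Matroid 4
C5 v = isUnit v ∨ allOnes v

-- Doubling: D(N) on F₂^{m+1} with hyperplane H = {0} × F₂^m and
-- a = e₁ ∉ H; E = (E ∩ H) ∪ (a + (E ∩ H)).
D : ∀ {m} → Matroid m → Matroid (suc m)
D N (b ∷ v) = not (isZero v) ∧ N v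

Dpow : ∀ {m} (k : ℕ) → Matroid m → Matroid (k + m)
Dpow zero    N = N
Dpow (suc k) N = D (Dpow k N)

private
  x1 x2 x3 x4 x5 x6 : V 6
  x1 = true  ∷ false ∷ false ∷ false ∷ false ∷ false ∷ []
  x2 = false ∷ true  ∷ false ∷ false ∷ false ∷ false ∷ []
  x3 = false ∷ false ∷ true  ∷ false ∷ false ∷ false ∷ []
  x4 = false ∷ false ∷ false ∷ true  ∷ false ∷ false ∷ []
  x5 = false ∷ false ∷ false ∷ false ∷ true  ∷ false ∷ []
  x6 = false ∷ false ∷ false ∷ false ∷ false ∷ true  ∷ []

kiteGround : List (V 6)
kiteGround = x1 L.∷ x2 L.∷ x3 L.∷ x4 L.∷ x5 L.∷ x6 L.∷
             (x1 ⊕ x2 ⊕ x3) L.∷ (x2 ⊕ x3 ⊕ x4) L.∷ (x1 ⊕ x3 ⊕ x5) L.∷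
             (x1 ⊕ x2 ⊕ x6) L.∷ L.[]

kite : Matroid 6
kite v = any (λ w → does (≡-dec BP._≟_ v w)) kiteGround

DoubledKite : (k : ℕ) → Matroid (k + 6)
DoubledKite k = Dpow k kite

module Submission where

-- Pick a basis f₀, f₁, …, f_q of F with M(f₀) = 1 and f₁, …, f_q spanning the hyperplane W, so that on F
-- the ground set is the first coordinate, and points pᵢ of E in the three cosets Aᵢ. In the coordinates of
-- p₁, p₂, p₃, f₀, …, f_q triangle-freeness and the I₃ hypothesis fix M everywhere except on the sets
-- Sᵢ = {w : pᵢ + Σ wⱼfⱼ ∈ E}. Five points f₀, f₀ + Σ uⱼfⱼ, pᵢ + Σ sᵢⱼfⱼ would form an I₅ if every Sᵢ jumped
-- along u, so every u ≠ 0 is a period of some Sᵢ: the three period spaces cover F₂^q. Either one of them is the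
-- whole space, so Sᵢ is everything and cl(F ∪ Aᵢ) is affine, or they are the three hyperplanes ker ψ₁, ker ψ₂,
-- ker (ψ₁ + ψ₂) of a pencil, each Sᵢ is its period space, and a basis adapted to ψ₁, ψ₂ exhibits the doubled kite.

open import Defs
open import Data.Nat using (ℕ; _≤_; _∸_; zero; suc; _+_; z≤n; s≤s)
import Data.Nat.Properties as ℕ
open import Data.Fin using (Fin; zero; suc)
open import Data.Fin.Subset using (⁅_⁆)
open import Data.Fin.Subset.Properties using (anySubset?)
open import Data.Bool using (Bool; true; false; not; _∧_; _xor_)
open import Data.Bool.Properties using (xor-same; xor-comm; xor-assoc; xor-identityˡ; xor-identityʳ; ∧-zeroʳ; ∧-identityʳ; ¬-not)
import Data.Bool.Properties as Bool
open import Data.Vec using (Vec; lookup; _∷_; []; head; tail; drop; splitAt; map; tabulate; zipWith; _++_)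
open import Data.Vec.Properties
  using (++-injectiveˡ; ++-injectiveʳ; zipWith-comm; zipWith-assoc; zipWith-identityˡ; zipWith-identityʳ; zipWith-++; lookup∘tabulate; tabulate-∘; ≡-dec)
open import Data.Vec.Relation.Unary.All as All using (All; []; _∷_)
open import Data.Vec.Relation.Unary.All.Properties using (lookup⁻; map⁺)
open import Data.List using (List; foldr)
import Data.List as List
import Data.List.Relation.Unary.All as ListAll
open import Data.Product using (Σ; _×_; _,_; ∃; proj₁; proj₂)
import Data.Product
open import Data.Sum using (_⊎_; inj₁; inj₂)
import Data.Sum
open import Data.Empty using (⊥; ⊥-elim)
open import Function using (_∘_; id)
open import Function.Bundles using (_⇔_; mk⇔; Equivalence)
open import Relation.Binary.PropositionalEquality
open import Relation.Nullary using (¬_; Dec; yes; no; does; contradiction)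
open import Relation.Nullary.Decidable using (toWitness; _→-dec_; _⊎-dec_; _×-dec_; ¬?; map′; decidable-stable; dec-true; dec-false)
open import Relation.Unary using (_∪_; _⊆_)

-- Linear algebra over F₂

⊕-comm : ∀ {n} (x y : V n) → x ⊕ y ≡ y ⊕ x
⊕-comm = zipWith-comm xor-comm

⊕-assoc : ∀ {n} (x y z : V n) → (x ⊕ y) ⊕ z ≡ x ⊕ (y ⊕ z)
⊕-assoc = zipWith-assoc xor-assoc

⊕-identityˡ : ∀ {n} (x : V n) → 0v ⊕ x ≡ x
⊕-identityˡ = zipWith-identityˡ xor-identityˡ

⊕-identityʳ : ∀ {n} (x : V n) → x ⊕ 0v ≡ x
⊕-identityʳ = zipWith-identityʳ xor-identityʳ

⊕-self : ∀ {n} (x : V n) → x ⊕ x ≡ 0v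
⊕-self []      = refl
⊕-self (a ∷ x) = cong₂ _∷_ (xor-same a) (⊕-self x)

⊕-cancelˡ : ∀ {n} (x y : V n) → x ⊕ (x ⊕ y) ≡ y
⊕-cancelˡ x y = begin
  x ⊕ (x ⊕ y)  ≡⟨ ⊕-assoc x x y ⟨
  (x ⊕ x) ⊕ y  ≡⟨ cong (_⊕ y) (⊕-self x) ⟩
  0v ⊕ y       ≡⟨ ⊕-identityˡ y ⟩
  y            ∎
  where open ≡-Reasoning

⊕-cancelʳ : ∀ {n} (x y : V n) → (x ⊕ y) ⊕ y ≡ x
⊕-cancelʳ x y = begin
  (x ⊕ y) ⊕ y  ≡⟨ ⊕-assoc x y y ⟩
  x ⊕ (y ⊕ y)  ≡⟨ cong (x ⊕_) (⊕-self y) ⟩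
  x ⊕ 0v       ≡⟨ ⊕-identityʳ x ⟩
  x            ∎
  where open ≡-Reasoning

⊕≡0v⇒≡ : ∀ {n} {x y : V n} → x ⊕ y ≡ 0v → x ≡ y
⊕≡0v⇒≡ {x = x} {y} e = trans (sym (⊕-cancelʳ x y)) (trans (cong (_⊕ y) e) (⊕-identityˡ y))

⊕-interchange : ∀ {n} (a b c d : V n) → (a ⊕ b) ⊕ (c ⊕ d) ≡ (a ⊕ c) ⊕ (b ⊕ d)
⊕-interchange a b c d = begin
  (a ⊕ b) ⊕ (c ⊕ d)  ≡⟨ ⊕-assoc a b (c ⊕ d) ⟩
  a ⊕ (b ⊕ (c ⊕ d))  ≡⟨ cong (a ⊕_) (⊕-assoc b c d) ⟨
  a ⊕ ((b ⊕ c) ⊕ d)  ≡⟨ cong (λ z → a ⊕ (z ⊕ d)) (⊕-comm b c) ⟩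
  a ⊕ ((c ⊕ b) ⊕ d)  ≡⟨ cong (a ⊕_) (⊕-assoc c b d) ⟩
  a ⊕ (c ⊕ (b ⊕ d))  ≡⟨ ⊕-assoc a c (b ⊕ d) ⟨
  (a ⊕ c) ⊕ (b ⊕ d)  ∎
  where open ≡-Reasoning

0v++0v : ∀ n {m} → 0v {n} ++ 0v {m} ≡ 0v
0v++0v zero    = refl
0v++0v (suc n) = cong (false ∷_) (0v++0v n)

scale : ∀ {n} → Bool → V n → V n
scale true  x = x
scale false x = 0v

scale-xor : ∀ {n} (a b : Bool) (x : V n) → scale (a xor b) x ≡ scale a x ⊕ scale b x
scale-xor true  true  x = sym (⊕-self x)
scale-xor true  false x = sym (⊕-identityʳ x)
scale-xor false b     x = sym (⊕-identityˡ (scale b x))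

lincomb-∷ : ∀ {n k} c (cs : Vec Bool k) (x : V n) xs → lincomb (c ∷ cs) (x ∷ xs) ≡ scale c x ⊕ lincomb cs xs
lincomb-∷ true  cs x xs = refl
lincomb-∷ false cs x xs = sym (⊕-identityˡ _)

lincomb-0v : ∀ {n k} (b : Vec (V n) k) → lincomb 0v b ≡ 0v
lincomb-0v []      = refl
lincomb-0v (x ∷ b) = lincomb-0v b

lincomb-⊕ : ∀ {n k} (c d : Vec Bool k) (b : Vec (V n) k) → lincomb (c ⊕ d) b ≡ lincomb c b ⊕ lincomb d b
lincomb-⊕ []       []       []       = sym (⊕-self 0v)
lincomb-⊕ (c ∷ cs) (d ∷ ds) (x ∷ xs) = begin
  lincomb ((c xor d) ∷ (cs ⊕ ds)) (x ∷ xs)                  ≡⟨ lincomb-∷ (c xor d) (cs ⊕ ds) x xs ⟩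
  scale (c xor d) x ⊕ lincomb (cs ⊕ ds) xs                   ≡⟨ cong₂ _⊕_ (scale-xor c d x) (lincomb-⊕ cs ds xs) ⟩
  (scale c x ⊕ scale d x) ⊕ (lincomb cs xs ⊕ lincomb ds xs)  ≡⟨ ⊕-interchange _ _ _ _ ⟩
  (scale c x ⊕ lincomb cs xs) ⊕ (scale d x ⊕ lincomb ds xs)  ≡⟨ cong₂ _⊕_ (lincomb-∷ c cs x xs) (lincomb-∷ d ds x xs) ⟨
  lincomb (c ∷ cs) (x ∷ xs) ⊕ lincomb (d ∷ ds) (x ∷ xs)      ∎
  where open ≡-Reasoning

lincomb-++ : ∀ {n k l} (c : Vec Bool k) (d : Vec Bool l) (b : Vec (V n) k) (b′ : Vec (V n) l) →
  lincomb (c ++ d) (b ++ b′) ≡ lincomb c b ⊕ lincomb d b′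
lincomb-++ []          d []      b′ = sym (⊕-identityˡ _)
lincomb-++ (false ∷ c) d (x ∷ b) b′ = lincomb-++ c d b b′
lincomb-++ (true  ∷ c) d (x ∷ b) b′ = trans (cong (x ⊕_) (lincomb-++ c d b b′)) (sym (⊕-assoc x _ _))

lincomb-zipWith-++ : ∀ {n m k} (c : Vec Bool k) (H : Vec (V n) k) (T : Vec (V m) k) →
  lincomb c (zipWith _++_ H T) ≡ lincomb c H ++ lincomb c T
lincomb-zipWith-++ {n} []      []      []      = sym (0v++0v n)
lincomb-zipWith-++ (false ∷ c) (h ∷ H) (t ∷ T) = lincomb-zipWith-++ c H T
lincomb-zipWith-++ (true  ∷ c) (h ∷ H) (t ∷ T) =
  trans (cong ((h ++ t) ⊕_) (lincomb-zipWith-++ c H T)) (zipWith-++ _xor_ h t (lincomb c H) (lincomb c T))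

lincomb-⁅⁆ : ∀ {n k} (b : Vec (V n) k) i → lincomb ⁅ i ⁆ b ≡ lookup b i
lincomb-⁅⁆ (x ∷ b) zero    = trans (cong (x ⊕_) (lincomb-0v b)) (⊕-identityʳ x)
lincomb-⁅⁆ (x ∷ b) (suc i) = lincomb-⁅⁆ b i

⁅⁆≢0v : ∀ {k} (i : Fin k) → ⁅ i ⁆ ≢ 0v
⁅⁆≢0v zero    ()
⁅⁆≢0v (suc i) e = ⁅⁆≢0v i (cong tail e)

Additive : ∀ {m n} → (V m → V n) → Set
Additive f = ∀ u v → f (u ⊕ v) ≡ f u ⊕ f v

additive-0v : ∀ {m n} (f : V m → V n) → Additive f → f 0v ≡ 0v
additive-0v f f-add = begin
  f 0v                ≡⟨ ⊕-cancelʳ (f 0v) (f 0v) ⟨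
  (f 0v ⊕ f 0v) ⊕ f 0v  ≡⟨ cong (_⊕ f 0v) (f-add 0v 0v) ⟨
  f (0v ⊕ 0v) ⊕ f 0v    ≡⟨ cong (λ z → f z ⊕ f 0v) (⊕-self 0v) ⟩
  f 0v ⊕ f 0v          ≡⟨ ⊕-self (f 0v) ⟩
  0v                  ∎
  where open ≡-Reasoning

lincomb-map : ∀ {m n k} (f : V m → V n) → Additive f → ∀ (c : Vec Bool k) B → lincomb c (map f B) ≡ f (lincomb c B)
lincomb-map f f-add []          []      = sym (additive-0v f f-add)
lincomb-map f f-add (false ∷ c) (x ∷ B) = lincomb-map f f-add c B
lincomb-map f f-add (true  ∷ c) (x ∷ B) = trans (cong (f x ⊕_) (lincomb-map f f-add c B)) (sym (f-add x _))

infixl 7 _·_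
_·_ : ∀ {n m k} → Vec (V m) k → Vec (V n) m → Vec (V n) k
G · B = map (λ g → lincomb g B) G

lincomb-assoc : ∀ {n m k} (c : Vec Bool k) (G : Vec (V m) k) (B : Vec (V n) m) →
  lincomb c (G · B) ≡ lincomb (lincomb c G) B
lincomb-assoc c G B = lincomb-map (λ g → lincomb g B) (λ u v → lincomb-⊕ u v B) c G

standardBasis : ∀ N → Vec (V N) N
standardBasis N = tabulate ⁅_⁆

lincomb-standardBasis : ∀ {N} (c : V N) → lincomb c (standardBasis N) ≡ c
lincomb-standardBasis {zero}  []      = refl
lincomb-standardBasis {suc N} (a ∷ c) = begin
  lincomb (a ∷ c) (⁅ zero ⁆ ∷ tabulate ((false ∷_) ∘ ⁅_⁆))         ≡⟨ cong (λ B → lincomb (a ∷ c) (⁅ zero ⁆ ∷ B)) (tabulate-∘ (false ∷_) ⁅_⁆) ⟩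
  lincomb (a ∷ c) (⁅ zero ⁆ ∷ map (false ∷_) (standardBasis N))   ≡⟨ lincomb-∷ a c _ _ ⟩
  scale a ⁅ zero ⁆ ⊕ lincomb c (map (false ∷_) (standardBasis N)) ≡⟨ cong (scale a ⁅ zero ⁆ ⊕_) (lincomb-map (false ∷_) (λ _ _ → refl) c _) ⟩
  scale a ⁅ zero ⁆ ⊕ (false ∷ lincomb c (standardBasis N))        ≡⟨ cong (λ z → scale a ⁅ zero ⁆ ⊕ (false ∷ z)) (lincomb-standardBasis c) ⟩
  scale a ⁅ zero ⁆ ⊕ (false ∷ c)                                  ≡⟨ first a ⟩
  a ∷ c                                                          ∎
  where
  open ≡-Reasoning
  first : ∀ a → scale a ⁅ zero ⁆ ⊕ (false ∷ c) ≡ a ∷ c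
  first true  = cong (true ∷_) (⊕-identityˡ c)
  first false = ⊕-identityˡ (false ∷ c)

standardBasis-LinInd : ∀ N → LinInd (standardBasis N)
standardBasis-LinInd N c e = trans (sym (lincomb-standardBasis c)) e

InSpan-0v : ∀ {n k} (b : Vec (V n) k) → InSpan b 0v
InSpan-0v b = 0v , lincomb-0v b

InSpan-⊕ : ∀ {n k} (b : Vec (V n) k) {x y} → InSpan b x → InSpan b y → InSpan b (x ⊕ y)
InSpan-⊕ b (c , refl) (d , refl) = c ⊕ d , lincomb-⊕ c d b

InSpan-scale : ∀ {n k} (b : Vec (V n) k) {x} t → InSpan b x → InSpan b (scale t x)
InSpan-scale b true  sp = sp
InSpan-scale b false sp = InSpan-0v b

InSpan-lookup : ∀ {n k} (b : Vec (V n) k) i → InSpan b (lookup b i)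
InSpan-lookup b i = ⁅ i ⁆ , lincomb-⁅⁆ b i

InSpan-members : ∀ {n k} (b : Vec (V n) k) → All (InSpan b) b
InSpan-members b = lookup⁻ (InSpan-lookup b)

InSpan-∷ : ∀ {n k} {b : Vec (V n) k} {x} y → InSpan b x → InSpan (y ∷ b) x
InSpan-∷ y (c , e) = false ∷ c , e

InSpan-++ʳ : ∀ {n k l} (b : Vec (V n) k) {b′ : Vec (V n) l} {x} → InSpan b′ x → InSpan (b ++ b′) x
InSpan-++ʳ b {b′} (c , e) = 0v ++ c , trans (lincomb-++ 0v c b b′) (trans (cong (_⊕ lincomb c b′) (lincomb-0v b)) (trans (⊕-identityˡ _) e))

All-InSpan⇒· : ∀ {n k m} {b : Vec (V n) k} {ys : Vec (V n) m} → All (InSpan b) ys → Σ (Vec (V k) m) λ G → ys ≡ G · b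
All-InSpan⇒· []              = [] , refl
All-InSpan⇒· ((g , refl) ∷ ps) with G , refl ← All-InSpan⇒· ps = g ∷ G , refl

InSpan-trans : ∀ {n k m} {b : Vec (V n) k} {ys : Vec (V n) m} → All (InSpan b) ys → ∀ {x} → InSpan ys x → InSpan b x
InSpan-trans {b = b} ps (c , refl) with G , refl ← All-InSpan⇒· ps = lincomb c G , sym (lincomb-assoc c G b)

InSpan-· : ∀ {n m k} (G : Vec (V m) k) (B : Vec (V n) m) → All (InSpan B) (G · B)
InSpan-· G B = map⁺ (All.universal (λ g → g , refl) G)

_≟v_ : ∀ {n} (x y : V n) → Dec (x ≡ y)
_≟v_ = ≡-dec Bool._≟_

InSpan? : ∀ {n k} (b : Vec (V n) k) x → Dec (InSpan b x)
InSpan? b x = anySubset? (λ c → lincomb c b ≟v x)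

∀? : ∀ {n} {P : V n → Set} → (∀ v → Dec (P v)) → Dec (∀ v → P v)
∀? P? = map′ (λ ¬cex v → decidable-stable (P? v) (λ ¬p → ¬cex (v , ¬p))) (λ all (v , ¬p) → ¬p (all v))
  (¬? (anySubset? (λ v → ¬? (P? v))))

¬∀⇒∃¬ : ∀ {n} {P : V n → Set} → (∀ v → Dec (P v)) → ¬ (∀ v → P v) → ∃ λ v → ¬ P v
¬∀⇒∃¬ P? ¬all = decidable-stable (anySubset? (λ v → ¬? (P? v))) λ none →
  ¬all λ v → decidable-stable (P? v) (λ ¬p → none (v , ¬p))

LinInd-injective : ∀ {n k} {b : Vec (V n) k} → LinInd b → ∀ {c d} → lincomb c b ≡ lincomb d b → c ≡ d
LinInd-injective {b = b} li {c} {d} e = ⊕≡0v⇒≡ (li (c ⊕ d) (trans (lincomb-⊕ c d b) (trans (cong (_⊕ lincomb d b) e) (⊕-self _))))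

LinInd-nonzero : ∀ {n k} {b : Vec (V n) k} → LinInd b → ∀ {c} → c ≢ 0v → lincomb c b ≢ 0v
LinInd-nonzero li c≢0 e = c≢0 (li _ e)

LinInd-tail : ∀ {n k} {x : V n} {xs : Vec (V n) k} → LinInd (x ∷ xs) → LinInd xs
LinInd-tail li c e = cong tail (li (false ∷ c) e)

LinInd-· : ∀ {n m k} {B : Vec (V n) m} {G : Vec (V m) k} → LinInd B → LinInd G → LinInd (G · B)
LinInd-· {B = B} {G} liB liG c e = liG c (liB _ (trans (sym (lincomb-assoc c G B)) e))

LinInd-∷ : ∀ {n k} {b : Vec (V n) k} {x} → LinInd b → ¬ InSpan b x → LinInd (x ∷ b)
LinInd-∷ li x∉ (false ∷ c) e = cong (false ∷_) (li c e)
LinInd-∷ li x∉ (true  ∷ c) e = contradiction (c , sym (⊕≡0v⇒≡ e)) x∉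

LinInd⇒head∉span : ∀ {n k} {x : V n} {xs : Vec (V n) k} → LinInd (x ∷ xs) → ¬ InSpan xs x
LinInd⇒head∉span {x = x} li (c , e) with () ← li (true ∷ c) (trans (cong (x ⊕_) e) (⊕-self x))

record Linear {n} (ψ : V n → Bool) : Set where
  constructor linear
  field xor-homo : ∀ x y → ψ (x ⊕ y) ≡ ψ x xor ψ y

open Linear

linear-0v : ∀ {n} {ψ : V n → Bool} → Linear ψ → ψ 0v ≡ false
linear-0v {ψ = ψ} lin = trans (cong ψ (sym (⊕-self 0v))) (trans (xor-homo lin 0v 0v) (xor-same (ψ 0v)))

linear-scale : ∀ {n} {ψ : V n → Bool} → Linear ψ → ∀ t x → ψ (scale t x) ≡ t ∧ ψ x
linear-scale lin true  x = refl
linear-scale lin false x = linear-0v lin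

linear-∷ : ∀ {n k} {ψ : V n → Bool} → Linear ψ → ∀ t (c : Vec Bool k) x xs →
  ψ (lincomb (t ∷ c) (x ∷ xs)) ≡ (t ∧ ψ x) xor ψ (lincomb c xs)
linear-∷ {ψ = ψ} lin t c x xs = trans (cong ψ (lincomb-∷ t c x xs)) (trans (xor-homo lin _ _) (cong (_xor ψ (lincomb c xs)) (linear-scale lin t x)))

linear-kernel : ∀ {n k} {ψ : V n → Bool} → Linear ψ → {zs : Vec (V n) k} → All (λ z → ψ z ≡ false) zs →
  ∀ c → ψ (lincomb c zs) ≡ false
linear-kernel lin []       []      = linear-0v lin
linear-kernel lin (p ∷ ps) (t ∷ c) = trans (linear-∷ lin t c _ _)
  (trans (cong₂ (λ a b → (t ∧ a) xor b) p (linear-kernel lin ps c)) (trans (xor-identityʳ _) (∧-zeroʳ t)))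

linear-transversal : ∀ {n k} {ψ : V n → Bool} → Linear ψ → ∀ {y} {zs : Vec (V n) k} → ψ y ≡ true →
  All (λ z → ψ z ≡ false) zs → ∀ t c → ψ (lincomb (t ∷ c) (y ∷ zs)) ≡ t
linear-transversal lin ψy ker t c = trans (linear-∷ lin t c _ _)
  (trans (cong₂ (λ a b → (t ∧ a) xor b) ψy (linear-kernel lin ker c)) (trans (xor-identityʳ _) (∧-identityʳ t)))

LinInd-transversal : ∀ {n k} {ψ : V n → Bool} → Linear ψ → ∀ {y} {zs : Vec (V n) k} → ψ y ≡ true →
  All (λ z → ψ z ≡ false) zs → LinInd zs → LinInd (y ∷ zs)
LinInd-transversal {ψ = ψ} lin ψy ker li (t ∷ c) e with trans (sym (linear-transversal lin ψy ker t c)) (trans (cong ψ e) (linear-0v lin))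
... | refl = cong (false ∷_) (li c e)

linear-skip : ∀ {n k} {ψ : V n → Bool} → Linear ψ → ∀ {x} → ψ x ≡ false → ∀ t (c : Vec Bool k) xs →
  ψ (lincomb (t ∷ c) (x ∷ xs)) ≡ ψ (lincomb c xs)
linear-skip lin ψx t c xs = trans (linear-∷ lin t c _ xs) (cong (_xor _) (trans (cong (t ∧_) ψx) (∧-zeroʳ t)))

eliminate : ∀ {n r} {ψ : V n → Bool} → Linear ψ → ∀ {x} {xs : Vec (V n) r} → ψ x ≡ true → LinInd (x ∷ xs) →
  Σ (Vec (V n) r) λ zs → LinInd zs × All (λ z → ψ z ≡ false) zs × All (InSpan (x ∷ xs)) zs
eliminate {ψ = ψ} lin {x} {xs} ψx li =
  map clear xs , LinInd-clear , map⁺ (All.universal ψ-clear xs) , map⁺ (All.map span-clear (InSpan-members xs))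
  where
  clear : _ → _
  clear z = z ⊕ scale (ψ z) x
  clear-additive : Additive clear
  clear-additive u v = begin
    (u ⊕ v) ⊕ scale (ψ (u ⊕ v)) x              ≡⟨ cong (λ s → (u ⊕ v) ⊕ scale s x) (xor-homo lin u v) ⟩
    (u ⊕ v) ⊕ scale (ψ u xor ψ v) x            ≡⟨ cong ((u ⊕ v) ⊕_) (scale-xor (ψ u) (ψ v) x) ⟩
    (u ⊕ v) ⊕ (scale (ψ u) x ⊕ scale (ψ v) x)  ≡⟨ ⊕-interchange u v _ _ ⟩
    clear u ⊕ clear v                          ∎
    where open ≡-Reasoning
  ψ-clear : ∀ z → ψ (clear z) ≡ false
  ψ-clear z = trans (xor-homo lin z _)
    (trans (cong (ψ z xor_) (trans (linear-scale lin (ψ z) x) (trans (cong (ψ z ∧_) ψx) (∧-identityʳ (ψ z))))) (xor-same (ψ z)))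
  span-clear : ∀ {z} → InSpan xs z → InSpan (x ∷ xs) (clear z)
  span-clear {z} sp = InSpan-⊕ (x ∷ xs) (InSpan-∷ x sp) (InSpan-scale (x ∷ xs) (ψ z) (InSpan-lookup (x ∷ xs) zero))
  LinInd-clear : LinInd (map clear xs)
  LinInd-clear d e = cong tail (li (ψ (lincomb d xs) ∷ d) (begin
    lincomb (ψ (lincomb d xs) ∷ d) (x ∷ xs)    ≡⟨ lincomb-∷ _ d x xs ⟩
    scale (ψ (lincomb d xs)) x ⊕ lincomb d xs  ≡⟨ ⊕-comm _ _ ⟩
    clear (lincomb d xs)                       ≡⟨ lincomb-map clear clear-additive d xs ⟨
    lincomb d (map clear xs)                   ≡⟨ e ⟩
    0v                                         ∎))
    where open ≡-Reasoning

kernelBasis : ∀ {n r} {ψ : V n → Bool} → Linear ψ → (b : Vec (V n) (suc r)) → LinInd b →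
  ∀ c → ψ (lincomb c b) ≡ true →
  Σ (Vec (V n) r) λ zs → LinInd zs × All (λ z → ψ z ≡ false) zs × All (InSpan b) zs
kernelBasis {ψ = ψ} lin (x ∷ xs) li (t ∷ c) ψc with ψ x in ψx
... | true  = eliminate lin ψx li
... | false with xs | c | trans (sym (linear-skip lin ψx t c xs)) ψc
...   | []     | []     | ψ0 with () ← trans (sym ψ0) (linear-0v lin)
...   | y ∷ ys | c′     | ψc′ with zs , li-zs , ker , spans ← kernelBasis lin (y ∷ ys) (LinInd-tail li) c′ ψc′ =
  x ∷ zs , LinInd-∷ li-zs (λ sp → LinInd⇒head∉span li (InSpan-trans spans sp)) , ψx ∷ ker ,
  InSpan-lookup (x ∷ y ∷ ys) zero ∷ All.map (InSpan-∷ x) spans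

head-linear : ∀ {N} → Linear (head {n = N})
head-linear = linear λ { (a ∷ x) (b ∷ y) → refl }

LinInd-tails : ∀ {N k} {zs : Vec (V (suc N)) k} → (∀ c → head (lincomb c zs) ≡ false) →
  LinInd zs → LinInd (map tail zs)
LinInd-tails {zs = zs} heads li c e = li c (begin
  lincomb c zs                                        ≡⟨ split (lincomb c zs) ⟩
  head (lincomb c zs) ∷ tail (lincomb c zs) ≡⟨ cong₂ _∷_ (heads c) (sym (lincomb-map tail tail-additive c zs)) ⟩
  false ∷ lincomb c (map tail zs)            ≡⟨ cong (false ∷_) e ⟩
  0v                                                  ∎)
  where
  open ≡-Reasoning
  split : ∀ {m} (v : V (suc m)) → v ≡ head v ∷ tail v
  split (a ∷ v) = refl
  tail-additive : Additive (tail {n = _})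
  tail-additive (a ∷ u) (b ∷ v) = refl

¬LinInd-overfull : ∀ {N} (G : Vec (V N) (suc N)) → ¬ LinInd G
¬LinInd-overfull {zero}  ([] ∷ []) li with () ← li (true ∷ []) refl
¬LinInd-overfull {suc N} G@(_ ∷ _) li with anySubset? (λ c → head (lincomb c G) Bool.≟ true)
... | yes (c , hc) with zs , li-zs , ker , _ ← kernelBasis head-linear G li c hc =
  ¬LinInd-overfull (map tail zs) (LinInd-tails (linear-kernel head-linear ker) li-zs)
... | no none = ¬LinInd-overfull (map tail (tail G))
  (LinInd-tail (LinInd-tails (λ c → ¬-not (λ hc → none (c , hc))) li))

LinInd-in-smaller-span : ∀ {n k} (b : Vec (V n) (suc k)) (a : Vec (V n) k) → LinInd b → ¬ All (InSpan a) b
LinInd-in-smaller-span b a li b⊆a with G , refl ← All-InSpan⇒· b⊆a =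
  ¬LinInd-overfull G (λ c e → li c (trans (lincomb-assoc c G a) (trans (cong (λ g → lincomb g a) e) (lincomb-0v a))))

LinInd⇒spanning : ∀ {N m} → m ≡ N → (G : Vec (V N) m) → LinInd G → ∀ v → InSpan G v
LinInd⇒spanning refl G li v = decidable-stable (InSpan? G v) (λ v∉ → ¬LinInd-overfull (v ∷ G) (LinInd-∷ li v∉))

commonKernelBasis : ∀ {r} {ψ₁ ψ₂ : V (suc (suc r)) → Bool} → Linear ψ₁ → Linear ψ₂ →
  ∀ {α β} → ψ₂ α ≡ true → ψ₁ β ≡ true → ψ₂ β ≡ false →
  Σ (Vec (V (suc (suc r))) r) λ κs → LinInd κs × All (λ κ → ψ₁ κ ≡ false) κs × All (λ κ → ψ₂ κ ≡ false) κs
commonKernelBasis {r} {ψ₁} {ψ₂} lin₁ lin₂ {α} {β} ψ₂α ψ₁β ψ₂β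
  with zs , li-zs , ker₂ , _ ← kernelBasis lin₂ (standardBasis _) (standardBasis-LinInd _) α (trans (cong ψ₂ (lincomb-standardBasis α)) ψ₂α)
  with b ∷ d , β≡ ← LinInd⇒spanning refl (α ∷ zs) (LinInd-transversal lin₂ ψ₂α ker₂ li-zs) β
  with refl ← trans (sym (linear-transversal lin₂ ψ₂α ker₂ b d)) (trans (cong ψ₂ β≡) ψ₂β)
  with κs , li-κs , ker₁ , κs⊆zs ← kernelBasis lin₁ zs li-zs d (trans (cong ψ₁ β≡) ψ₁β)
  = κs , li-κs , ker₁ , All.map (λ { (c , refl) → linear-kernel lin₂ ker₂ c }) κs⊆zs

-- Flats, bases and restrictions

Span : ∀ {n k} → Vec (V n) k → PointSet n
Span b z = z ≢ 0v × InSpan b z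

⟨Span⟩⇒InSpan : ∀ {n k} {b : Vec (V n) k} {z} → ⟨ Span b ⟩ z → InSpan b z
⟨Span⟩⇒InSpan {b = b} (inj₁ refl) = InSpan-0v b
⟨Span⟩⇒InSpan         (inj₂ (_ , sp)) = sp

InSpan⇒⟨Span⟩ : ∀ {n k} {b : Vec (V n) k} {z} → InSpan b z → ⟨ Span b ⟩ z
InSpan⇒⟨Span⟩ {z = z} sp with z ≟v 0v
... | yes z≡0 = inj₁ z≡0
... | no  z≢0 = inj₂ (z≢0 , sp)

Span-isFlat : ∀ {n k} (b : Vec (V n) k) → IsFlat (Span b)
Span-isFlat b = (λ _ → proj₁) , λ _ _ x∈ y∈ → InSpan⇒⟨Span⟩ (InSpan-⊕ b (⟨Span⟩⇒InSpan x∈) (⟨Span⟩⇒InSpan y∈))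

Span-basis : ∀ {n k} {b : Vec (V n) k} → LinInd b → IsBasis (Span b) b
Span-basis li = li , λ _ → mk⇔ id id

basis⊆ : ∀ {n k} {X : PointSet n} {b : Vec (V n) k} → IsBasis X b → All X b
basis⊆ {b = b} (li , X⇔) = lookup⁻ λ i →
  Equivalence.from (X⇔ _) (subst (_≢ 0v) (lincomb-⁅⁆ b i) (LinInd-nonzero li (⁅⁆≢0v i)) , InSpan-lookup b i)

⟨F⟩⊆span : ∀ {n k} {F : PointSet n} {B : Vec (V n) k} → IsBasis F B → ∀ {f} → ⟨ F ⟩ f → InSpan B f
⟨F⟩⊆span {B = B} _             (inj₁ refl) = InSpan-0v B
⟨F⟩⊆span         (_ , F⇔) (inj₂ f∈F) = proj₂ (Equivalence.to (F⇔ _) f∈F)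

lincomb∈⟨⟩ : ∀ {n k} {X : PointSet n} {B : Vec (V n) k} → IsBasis X B → ∀ c → ⟨ X ⟩ (lincomb c B)
lincomb∈⟨⟩ {B = B} (_ , X⇔) c with lincomb c B ≟v 0v
... | yes z≡0 = inj₁ z≡0
... | no  z≢0 = inj₂ (Equivalence.from (X⇔ _) (z≢0 , c , refl))

IsBasis-reindex : ∀ {n m k} {X : PointSet n} {B : Vec (V n) m} → IsBasis X B → k ≡ m →
  (G : Vec (V m) k) → LinInd G → IsBasis X (G · B)
IsBasis-reindex {B = B} (liB , X⇔) k≡m G liG =
  LinInd-· liB liG , λ x → mk⇔ (Data.Product.map₂ B⇒G·B ∘ to (X⇔ x)) (from (X⇔ x) ∘ Data.Product.map₂ (InSpan-trans (InSpan-· G B)))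
  where
  open Equivalence
  B⇒G·B : ∀ {x} → InSpan B x → InSpan (G · B) x
  B⇒G·B (c , refl) with d , refl ← LinInd⇒spanning k≡m G liG c = d , lincomb-assoc d G B

select : ∀ {A : Set} {k} → Vec Bool k → Vec A k → List A
select []          []      = List.[]
select (true  ∷ c) (x ∷ b) = x List.∷ select c b
select (false ∷ c) (x ∷ b) = select c b

sum-select : ∀ {n k} (c : Vec Bool k) (b : Vec (V n) k) → foldr _⊕_ 0v (select c b) ≡ lincomb c b
sum-select []          []      = refl
sum-select (true  ∷ c) (x ∷ b) = cong (x ⊕_) (sum-select c b)
sum-select (false ∷ c) (x ∷ b) = sum-select c b

All-select : ∀ {A : Set} {P : A → Set} {k} (c : Vec Bool k) {b : Vec A k} → All P b → ListAll.All P (select c b)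
All-select []          []       = ListAll.[]
All-select (true  ∷ c) (p ∷ ps) = p ListAll.∷ All-select c ps
All-select (false ∷ c) (p ∷ ps) = All-select c ps

Cl-spanned : ∀ {n k} {X : PointSet n} {b : Vec (V n) k} → (∀ {z} → X z → InSpan b z) → All X b →
  ∀ x → Cl X x ⇔ Span b x
Cl-spanned {X = X} {b} X⊆b b⊆X x = mk⇔
  (λ (x≢0 , xs , xs⊆X , e) → x≢0 , subst (InSpan b) e (InSpan-sum xs⊆X))
  (λ (x≢0 , c , e) → x≢0 , select c b , All-select c b⊆X , trans (sum-select c b) e)
  where
  InSpan-sum : ∀ {xs} → ListAll.All X xs → InSpan b (foldr _⊕_ 0v xs)
  InSpan-sum ListAll.[]         = InSpan-0v b
  InSpan-sum (px ListAll.∷ pxs) = InSpan-⊕ b (X⊆b px) (InSpan-sum pxs)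

pull : ∀ {n k} → Matroid n → Vec (V n) k → Matroid k
pull M B c = M (lincomb c B)

infix 4 _≈ᴹ_
_≈ᴹ_ : ∀ {k} → Matroid k → Matroid k → Set
M ≈ᴹ N = ∀ c → c ≢ 0v → M c ≡ N c

Free⇒pull : ∀ {n m k} {M : Matroid n} {N : Matroid k} → Free M N → {B : Vec (V n) m} → LinInd B →
  ∀ {G : Vec (V m) k} → LinInd G → ¬ (pull (pull M B) G ≈ᴹ N)
Free⇒pull {M = M} fr {B} liB {G} liG eq =
  fr (Span (G · B)) (Span-isFlat (G · B)) (G · B , Span-basis (LinInd-· liB liG) , λ c c≢0 → trans (cong M (lincomb-assoc c G B)) (eq c c≢0))

IsoRestr-reindex : ∀ {n m k} {M : Matroid n} {X : PointSet n} {B : Vec (V n) m} {N : Matroid k} →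
  IsBasis X B → k ≡ m → (G : Vec (V m) k) → LinInd G → pull (pull M B) G ≈ᴹ N → IsoRestr M X N
IsoRestr-reindex {M = M} {B = B} X-basis k≡m G liG eq =
  G · B , IsBasis-reindex X-basis k≡m G liG , λ c c≢0 → trans (cong M (lincomb-assoc c G B)) (eq c c≢0)

TriangleFree⇒sum∉E : ∀ {n} {M : Matroid n} → TriangleFree M → ∀ {x y} → Gr M x → Gr M y → ¬ Gr M (x ⊕ y)
TriangleFree⇒sum∉E {n} {M} tf {x} {y} x∈E y∈E x⊕y∈E = tf (Span T) (Span-isFlat T) (T , Span-basis li) T⊆E
  where
  T : Vec (V n) 2
  T = x ∷ y ∷ []
  points : ∀ c → c ≢ 0v → Gr M (lincomb c T)
  points (true  ∷ true  ∷ []) _ = subst (Gr M) (cong (x ⊕_) (sym (⊕-identityʳ y))) x⊕y∈E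
  points (true  ∷ false ∷ []) _ = subst (Gr M) (sym (⊕-identityʳ x)) x∈E
  points (false ∷ true  ∷ []) _ = subst (Gr M) (sym (⊕-identityʳ y)) y∈E
  points (false ∷ false ∷ []) c≢0 = ⊥-elim (c≢0 refl)
  li : LinInd T
  li c e = decidable-stable (c ≟v 0v) (λ c≢0 → proj₁ (points c c≢0) e)
  T⊆E : Span T ⊆ Gr M
  T⊆E (z≢0 , c , refl) = points c (λ c≡0 → z≢0 (trans (cong (λ d → lincomb d T) c≡0) (lincomb-0v T)))

IsAffine-xor : ∀ {n k} {M : Matroid n} {X : PointSet n} {B : Vec (V n) (suc (suc k))} →
  IsBasis X B → (∀ e t w → (e ∷ t ∷ w) ≢ 0v → pull M B (e ∷ t ∷ w) ≡ e xor t) → IsAffine M X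
IsAffine-xor {k = k} {M} {X} {b₀ ∷ b₁ ∷ bs} X-basis@(li , X⇔) value =
  Span H , (Span-isFlat H , H⊆X , suc k , (B , X-basis) , (H , Span-basis liH)) , affine
  where
  open Equivalence
  B H : Vec _ _
  B = b₀ ∷ b₁ ∷ bs
  H = (b₀ ⊕ b₁) ∷ bs
  H-coords : ∀ h w → lincomb (h ∷ w) H ≡ lincomb (h ∷ h ∷ w) B
  H-coords true  w = ⊕-assoc b₀ b₁ _
  H-coords false w = refl
  liH : LinInd H
  liH (h ∷ w) e with refl ← li (h ∷ h ∷ w) (trans (sym (H-coords h w)) e) = refl
  H⊆X : Span H ⊆ X
  H⊆X {x} (x≢0 , (h ∷ w) , refl) = from (X⇔ x) (x≢0 , h ∷ h ∷ w , sym (H-coords h w))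
  distinct : ∀ {a b} → a ≢ b → a xor b ≡ true
  distinct {true}  {false} _ = refl
  distinct {false} {true}  _ = refl
  distinct {true}  {true}  a≢b = ⊥-elim (a≢b refl)
  distinct {false} {false} a≢b = ⊥-elim (a≢b refl)
  affine : ∀ x → X x → Gr M x ⇔ (¬ Span H x)
  affine x x∈X with to (X⇔ x) x∈X
  ... | x≢0 , (e ∷ t ∷ w) , refl = mk⇔ E⇒∉H ∉H⇒E
    where
    M-x : M x ≡ e xor t
    M-x = value e t w (λ c≡0 → x≢0 (trans (cong (λ c → lincomb c B) c≡0) (lincomb-0v B)))
    E⇒∉H : Gr M x → ¬ Span H x
    E⇒∉H (_ , x∈E) (_ , (h ∷ w′) , x∈H) with refl ← LinInd-injective li {h ∷ h ∷ w′} {e ∷ t ∷ w} (trans (sym (H-coords h w′)) x∈H)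
      with () ← trans (sym x∈E) (trans M-x (xor-same h))
    ∉H⇒E : ¬ Span H x → Gr M x
    ∉H⇒E x∉H with e Bool.≟ t
    ... | yes refl = ⊥-elim (x∉H (x≢0 , e ∷ w , H-coords e w))
    ... | no  e≢t  = x≢0 , trans M-x (distinct e≢t)

module _ {n} {F : PointSet n} (F-flat : IsFlat F) where

  Coset-⊕ : ∀ {a x f} → Coset F a x → ⟨ F ⟩ f → Coset F a (x ⊕ f)
  Coset-⊕ {a} {f = f} (g , g∈F , refl) f∈F = g ⊕ f , proj₂ F-flat g f g∈F f∈F , ⊕-assoc a g f

  Coset-diff : ∀ {a x y} → Coset F a x → Coset F a y → ⟨ F ⟩ (x ⊕ y)
  Coset-diff {a} (f , f∈F , refl) (g , g∈F , refl) =
    subst ⟨ F ⟩ (sym (trans (⊕-interchange a f a g) (trans (cong (_⊕ (f ⊕ g)) (⊕-self a)) (⊕-identityˡ _))))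
      (proj₂ F-flat f g f∈F g∈F)

  lincomb-Coset : ∀ {k} (a ps : Vec (V n) k) → (∀ i → Coset F (lookup a i) (lookup ps i)) →
    ∀ e → Coset F (lincomb e a) (lincomb e ps)
  lincomb-Coset []      []      _  []          = 0v , inj₁ refl , sym (⊕-self 0v)
  lincomb-Coset (x ∷ a) (p ∷ ps) on (false ∷ e) = lincomb-Coset a ps (on ∘ suc) e
  lincomb-Coset (x ∷ a) (p ∷ ps) on (true  ∷ e) with f , f∈F , refl ← on zero
    with g , g∈F , eq ← lincomb-Coset a ps (on ∘ suc) e =
    f ⊕ g , proj₂ F-flat f g f∈F g∈F , trans (cong ((x ⊕ f) ⊕_) eq) (⊕-interchange x f _ g)

  Coset∋0v : ∀ {a} → Coset F a 0v → ⟨ F ⟩ a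
  Coset∋0v (f , f∈F , 0≡a⊕f) = subst ⟨ F ⟩ (sym (⊕≡0v⇒≡ (sym 0≡a⊕f))) f∈F

  Coset⊆span : ∀ {k a p} {C : Vec (V n) k} → (∀ {f} → ⟨ F ⟩ f → InSpan C f) → Coset F a p → InSpan C p →
    ∀ {x} → Coset F a x → InSpan C x
  Coset⊆span {p = p} {C} F⊆C p∈a p∈C {x} x∈a = subst (InSpan C) (⊕-cancelˡ p x) (InSpan-⊕ C p∈C (F⊆C (Coset-diff p∈a x∈a)))

indicator : ∀ {n} → Matroid n → V n → Bool
indicator M z = not (does (z ≟v 0v)) ∧ M z

indicator-0v : ∀ {n} (M : Matroid n) → indicator M 0v ≡ false
indicator-0v {n} M = cong (λ b → not b ∧ M 0v) (dec-true (0v {n} ≟v 0v) refl)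

indicator-nonzero : ∀ {n} (M : Matroid n) {z} → z ≢ 0v → indicator M z ≡ M z
indicator-nonzero M {z} z≢0 = cong (λ b → not b ∧ M z) (dec-false (z ≟v 0v) z≢0)

module _ {n} {M : Matroid n} {F W : PointSet n} (tf : TriangleFree M) (F-flat : IsFlat F) (W-flat : IsFlat W)
         (affine : ∀ x → F x → Gr M x ⇔ (¬ W x)) where

  private
    W-closed : ∀ {x y} → W x → W y → x ⊕ y ≢ 0v → W (x ⊕ y)
    W-closed {x} {y} x∈W y∈W x⊕y≢0 with proj₂ W-flat x y (inj₂ x∈W) (inj₂ y∈W)
    ... | inj₁ x⊕y≡0 = ⊥-elim (x⊕y≢0 x⊕y≡0)
    ... | inj₂ x⊕y∈W = x⊕y∈W

    ∉E⇒W : ∀ {x} → F x → M x ≡ false → ¬ ¬ W x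
    ∉E⇒W {x} x∈F Mx x∉W with () ← trans (sym Mx) (proj₂ (Equivalence.from (affine x x∈F) x∉W))

    E⇒∉W : ∀ {x} → F x → x ≢ 0v → M x ≡ true → ¬ W x
    E⇒∉W {x} x∈F x≢0 Mx = Equivalence.to (affine x x∈F) (x≢0 , Mx)

    F-closed : ∀ {x y} → F x → F y → x ⊕ y ≢ 0v → F (x ⊕ y)
    F-closed {x} {y} x∈F y∈F x⊕y≢0 with proj₂ F-flat x y (inj₂ x∈F) (inj₂ y∈F)
    ... | inj₁ x⊕y≡0 = ⊥-elim (x⊕y≢0 x⊕y≡0)
    ... | inj₂ x⊕y∈F = x⊕y∈F

    M-xor : ∀ {x y} → F x → F y → x ≢ 0v → y ≢ 0v → x ⊕ y ≢ 0v → M (x ⊕ y) ≡ M x xor M y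
    M-xor {x} {y} x∈F y∈F x≢0 y≢0 x⊕y≢0 with M x in Mx | M y in My | M (x ⊕ y) in Mxy
    ... | true  | true  | false = refl
    ... | true  | false | true  = refl
    ... | false | true  | true  = refl
    ... | false | false | false = refl
    ... | true  | true  | true  = ⊥-elim (TriangleFree⇒sum∉E tf (x≢0 , Mx) (y≢0 , My) (x⊕y≢0 , Mxy))
    ... | true  | false | false = ⊥-elim (∉E⇒W x⊕y∈F Mxy λ x⊕y∈W → ∉E⇒W y∈F My λ y∈W →
        E⇒∉W x∈F x≢0 Mx (subst W (⊕-cancelʳ x y) (W-closed x⊕y∈W y∈W (subst (_≢ 0v) (sym (⊕-cancelʳ x y)) x≢0))))
      where x⊕y∈F = F-closed x∈F y∈F x⊕y≢0
    ... | false | true  | false = ⊥-elim (∉E⇒W x∈F Mx λ x∈W → ∉E⇒W x⊕y∈F Mxy λ x⊕y∈W →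
        E⇒∉W y∈F y≢0 My (subst W (⊕-cancelˡ x y) (W-closed x∈W x⊕y∈W (subst (_≢ 0v) (sym (⊕-cancelˡ x y)) y≢0))))
      where x⊕y∈F = F-closed x∈F y∈F x⊕y≢0
    ... | false | false | true  = ⊥-elim (∉E⇒W x∈F Mx λ x∈W → ∉E⇒W y∈F My λ y∈W →
        E⇒∉W (F-closed x∈F y∈F x⊕y≢0) x⊕y≢0 Mxy (W-closed x∈W y∈W x⊕y≢0))

  indicator-additive : ∀ {x y} → ⟨ F ⟩ x → ⟨ F ⟩ y → indicator M (x ⊕ y) ≡ indicator M x xor indicator M y
  indicator-additive {x} {y} x∈F y∈F = by-cases (x ≟v 0v) (y ≟v 0v) (x ≟v y)
    where
    open ≡-Reasoning
    ind-zero : ∀ {z} → z ≡ 0v → indicator M z ≡ false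
    ind-zero refl = indicator-0v M
    inF : ∀ {z} → ⟨ F ⟩ z → z ≢ 0v → F z
    inF (inj₁ z≡0) z≢0 = ⊥-elim (z≢0 z≡0)
    inF (inj₂ z∈F) _   = z∈F
    by-cases : Dec (x ≡ 0v) → Dec (y ≡ 0v) → Dec (x ≡ y) → indicator M (x ⊕ y) ≡ indicator M x xor indicator M y
    by-cases (yes refl) _ _ = trans (cong (indicator M) (⊕-identityˡ y)) (cong (_xor indicator M y) (sym (indicator-0v M)))
    by-cases (no _) (yes refl) _ = trans (cong (indicator M) (⊕-identityʳ x)) (trans (sym (xor-identityʳ _)) (cong (indicator M x xor_) (sym (indicator-0v M))))
    by-cases (no _) (no _) (yes refl) = trans (ind-zero (⊕-self x)) (sym (xor-same (indicator M x)))
    by-cases (no x≢0) (no y≢0) (no x≢y) = begin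
      indicator M (x ⊕ y)             ≡⟨ indicator-nonzero M (x≢y ∘ ⊕≡0v⇒≡) ⟩
      M (x ⊕ y)                       ≡⟨ M-xor (inF x∈F x≢0) (inF y∈F y≢0) x≢0 y≢0 (x≢y ∘ ⊕≡0v⇒≡) ⟩
      M x xor M y                     ≡⟨ cong₂ _xor_ (indicator-nonzero M x≢0) (indicator-nonzero M y≢0) ⟨
      indicator M x xor indicator M y ∎

IsAffine⇒nonempty : ∀ {n} {M : Matroid n} {F : PointSet n} → IsAffine M F → Σ (V n) λ z → F z × Gr M z
IsAffine⇒nonempty {M = M} {F} (W , (_ , _ , _ , (bF , liF , F⇔) , (bW , _ , W⇔)) , affine)
  with anySubset? (λ c → ¬? (lincomb c bF ≟v 0v) ×-dec (M (lincomb c bF) Bool.≟ true))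
... | yes (c , z≢0 , z∈E) = lincomb c bF , Equivalence.from (F⇔ _) (z≢0 , c , refl) , z≢0 , z∈E
... | no none = ⊥-elim (LinInd-in-smaller-span bF bW liF (All.map inW (basis⊆ (liF , F⇔))))
  where
  open Equivalence
  inW : ∀ {z} → F z → InSpan bW z
  inW {z} z∈F with to (F⇔ z) z∈F
  ... | _ , c , refl = decidable-stable (InSpan? bW _) λ z∉W →
    none (c , from (affine _ z∈F) (z∉W ∘ proj₂ ∘ to (W⇔ _)))

adaptedBasis : ∀ {n q} {M : Matroid n} {F : PointSet n} → TriangleFree M → IsFlat F → HasDim F (suc q) → IsAffine M F →
  Σ (Vec (V n) (suc q)) λ B → IsBasis F B × (∀ t w → (t ∷ w) ≢ 0v → pull M B (t ∷ w) ≡ t)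
adaptedBasis {n} {q} {M} {F} tf F-flat (bF , F-basis@(liF , F⇔)) aff@(W , (W-flat , _) , affine) =
  adapted (IsAffine⇒nonempty aff)
  where
  open Equivalence
  ψ : V (suc q) → Bool
  ψ c = indicator M (lincomb c bF)
  ψ-linear : Linear ψ
  ψ-linear = linear λ c d →
    trans (cong (indicator M) (lincomb-⊕ c d bF)) (indicator-additive tf F-flat W-flat affine (lincomb∈⟨⟩ F-basis c) (lincomb∈⟨⟩ F-basis d))
  adapted : Σ (V n) (λ z → F z × Gr M z) → Σ (Vec (V n) (suc q)) λ B → IsBasis F B × (∀ t w → (t ∷ w) ≢ 0v → pull M B (t ∷ w) ≡ t)
  adapted (z , z∈F , z≢0 , z∈E) with to (F⇔ z) z∈F
  ... | _ , c₀ , refl with kernelBasis ψ-linear (standardBasis (suc q)) (standardBasis-LinInd (suc q)) c₀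
                            (trans (cong ψ (lincomb-standardBasis c₀)) (trans (indicator-nonzero M z≢0) z∈E))
  ... | ws , li-ws , ker , _ = G · bF , IsBasis-reindex F-basis refl G liG , value
    where
    ψc₀ : ψ c₀ ≡ true
    ψc₀ = trans (indicator-nonzero M z≢0) z∈E
    G : Vec (V (suc q)) (suc q)
    G = c₀ ∷ ws
    liG : LinInd G
    liG = LinInd-transversal ψ-linear ψc₀ ker li-ws
    value : ∀ t w → (t ∷ w) ≢ 0v → pull M (G · bF) (t ∷ w) ≡ t
    value t w tw≢0 = begin
      M (lincomb (t ∷ w) (G · bF))             ≡⟨ cong M (lincomb-assoc (t ∷ w) G bF) ⟩
      M (lincomb (lincomb (t ∷ w) G) bF)       ≡⟨ indicator-nonzero M (subst (_≢ 0v) (lincomb-assoc (t ∷ w) G bF) (LinInd-nonzero (LinInd-· liF liG) tw≢0)) ⟨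
      ψ (lincomb (t ∷ w) G)                    ≡⟨ linear-transversal ψ-linear ψc₀ ker t w ⟩
      t                                        ∎
      where open ≡-Reasoning

-- Periods of the three supports

record IsSubspace {q} (P : V q → Bool) : Set where
  field
    0v∈ : P 0v ≡ true
    ⊕-closed : ∀ {u v} → P u ≡ true → P v ≡ true → P (u ⊕ v) ≡ true

  cancel : ∀ {u v} → P u ≡ true → P (u ⊕ v) ≡ true → P v ≡ true
  cancel {u} {v} u∈ u⊕v∈ = trans (cong P (sym (⊕-cancelˡ u v))) (⊕-closed u∈ u⊕v∈)

  ⊕-∉ : ∀ {u v} → P u ≡ true → P v ≡ false → P (u ⊕ v) ≡ false
  ⊕-∉ {u} {v} u∈ v∉ = ¬-not λ u⊕v∈ → contradiction (trans (sym v∉) (cancel u∈ u⊕v∈)) λ ()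

  ∉-⊕ : ∀ {u v} → P u ≡ false → P v ≡ true → P (u ⊕ v) ≡ false
  ∉-⊕ {u} {v} u∉ v∈ = trans (cong P (⊕-comm u v)) (⊕-∉ v∈ u∉)

  ∉⇒≢0v : ∀ {u} → P u ≡ false → u ≢ 0v
  ∉⇒≢0v u∉ refl with () ← trans (sym u∉) 0v∈

ComplementClosed : ∀ {q} → (V q → Bool) → Set
ComplementClosed P = ∀ {u v} → P u ≡ false → P v ≡ false → P (u ⊕ v) ≡ true

hyperplane⇒linear : ∀ {q} {P : V q → Bool} → IsSubspace P → ComplementClosed P → Linear (not ∘ P)
hyperplane⇒linear {P = P} sub complement-closed = linear λ u v → go (P u) (P v) refl refl
  where
  open IsSubspace sub
  go : ∀ {u v} a b → P u ≡ a → P v ≡ b → not (P (u ⊕ v)) ≡ not a xor not b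
  go true  true  u∈ v∈ = cong not (⊕-closed u∈ v∈)
  go true  false u∈ v∉ = cong not (⊕-∉ u∈ v∉)
  go false true  u∉ v∈ = cong not (∉-⊕ u∉ v∈)
  go false false u∉ v∉ = cong not (complement-closed u∉ v∉)

Jumps : ∀ {q} → (V q → Bool) → V q → Set
Jumps f u = Σ (V _) λ s → f s ≡ true × f (s ⊕ u) ≡ false

module Periods {q} (f : V q → Bool) where

  isPeriod : V q → Bool
  isPeriod u = does (∀? λ s → f s Bool.≟ f (s ⊕ u))

  isPeriod-sound : ∀ {u} → isPeriod u ≡ true → ∀ s → f s ≡ f (s ⊕ u)
  isPeriod-sound {u} u∈ = decidable-stable (∀? λ s → f s Bool.≟ f (s ⊕ u)) λ ¬period →
    contradiction (trans (sym u∈) (dec-false (∀? λ s → f s Bool.≟ f (s ⊕ u)) ¬period)) λ ()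

  isPeriod-complete : ∀ {u} → (∀ s → f s ≡ f (s ⊕ u)) → isPeriod u ≡ true
  isPeriod-complete {u} = dec-true (∀? λ s → f s Bool.≟ f (s ⊕ u))

  isPeriod-subspace : IsSubspace isPeriod
  isPeriod-subspace = record
    { 0v∈      = isPeriod-complete λ s → cong f (sym (⊕-identityʳ s))
    ; ⊕-closed = λ {u} {v} u∈ v∈ → isPeriod-complete λ s →
        trans (isPeriod-sound u∈ s) (trans (isPeriod-sound v∈ (s ⊕ u)) (cong f (⊕-assoc s u v)))
    }

  nonPeriod⇒Jumps : ∀ {u} → isPeriod u ≡ false → Jumps f u
  nonPeriod⇒Jumps {u} u∉
    with s , ne ← ¬∀⇒∃¬ (λ s → f s Bool.≟ f (s ⊕ u)) (λ period → contradiction (trans (sym u∉) (isPeriod-complete period)) λ ())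
    with f s in fs | f (s ⊕ u) in fsu
  ... | true  | false = s , fs , fsu
  ... | false | true  = s ⊕ u , fsu , trans (cong f (⊕-cancelʳ s u)) fs
  ... | true  | true  = ⊥-elim (ne refl)
  ... | false | false = ⊥-elim (ne refl)

  period-value : ∀ {w} → f 0v ≡ true → isPeriod w ≡ true → f w ≡ true
  period-value {w} f0 w∈ = trans (cong f (sym (⊕-identityˡ w))) (trans (sym (isPeriod-sound w∈ 0v)) f0)

  support≡periods : f 0v ≡ true → ComplementClosed isPeriod → ∀ {n} → isPeriod n ≡ false → ∀ w → f w ≡ isPeriod w
  support≡periods f0 complement-closed {n} n∉ w with isPeriod w in w∈
  ... | true  = period-value f0 w∈
  ... | false = ¬-not λ fw → contradiction (trans (sym n∉) (isPeriod-complete λ s → trans (full fw s) (sym (full fw (s ⊕ n))))) λ ()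
    where
    full : f w ≡ true → ∀ s → f s ≡ true
    full fw s with isPeriod s in s∈
    ... | true  = period-value f0 s∈
    ... | false = trans (cong f (sym (⊕-cancelˡ w s))) (trans (sym (isPeriod-sound (complement-closed w∈ s∈) w)) fw)

module ThreeSubspaces {q} {Pa Pb Pc : V q → Bool} (sa : IsSubspace Pa) (sb : IsSubspace Pb) (sc : IsSubspace Pc)
  (cover : ∀ u → Pa u ≡ false → Pb u ≡ false → Pc u ≡ false → ⊥) where

  private
    module A = IsSubspace sa
    module B = IsSubspace sb
    module C = IsSubspace sc

    covered : ∀ {u} → Pa u ≡ false → Pb u ≡ false → Pc u ≡ true
    covered {u} u∉a u∉b = ¬-not (cover u u∉a u∉b)

  outside-others : ∀ {nb nc} → Pb nb ≡ false → Pc nc ≡ false → Σ (V q) λ α → Pa α ≡ true × Pb α ≡ false × Pc α ≡ false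
  outside-others {nb} {nc} nb∉ nc∉ = decidable-stable (anySubset? λ α → Pa α Bool.≟ true ×-dec Pb α Bool.≟ false ×-dec Pc α Bool.≟ false)
    λ none →
      let b∪c : ∀ {u} → Pb u ≡ false → Pc u ≡ true
          b∪c {u} u∉b = ¬-not λ u∉c → none (u , ¬-not (λ u∉a → cover u u∉a u∉b u∉c) , u∉b , u∉c)
          nc∈b : Pb nc ≡ true
          nc∈b = ¬-not λ nc∉b → contradiction (trans (sym nc∉) (b∪c nc∉b)) λ ()
      in contradiction (trans (sym nc∉) (C.cancel (b∪c nb∉) (b∪c (B.∉-⊕ nb∉ nc∈b)))) λ ()

  module _ {α} (α∈a : Pa α ≡ true) (α∉b : Pb α ≡ false) (α∉c : Pc α ≡ false) where

    meet⊆ : ∀ {u} → Pb u ≡ true → Pc u ≡ true → Pa u ≡ true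
    meet⊆ {u} u∈b u∈c = ¬-not λ u∉a →
      cover (u ⊕ α) (A.∉-⊕ u∉a α∈a) (B.⊕-∉ u∈b α∉b) (C.⊕-∉ u∈c α∉c)

    private
      b⇒c : ∀ {u} → Pa u ≡ false → Pb u ≡ true → Pc (u ⊕ α) ≡ true
      b⇒c u∉a u∈b = covered (A.∉-⊕ u∉a α∈a) (B.⊕-∉ u∈b α∉b)

      c⇒b : ∀ {u} → Pa u ≡ false → Pc u ≡ true → Pb (u ⊕ α) ≡ true
      c⇒b {u} u∉a u∈c = ¬-not λ u⊕α∉b → cover (u ⊕ α) (A.∉-⊕ u∉a α∈a) u⊕α∉b (C.⊕-∉ u∈c α∉c)

      shift² : ∀ u v → (u ⊕ α) ⊕ (v ⊕ α) ≡ u ⊕ v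
      shift² u v = trans (⊕-interchange u α v α) (trans (cong ((u ⊕ v) ⊕_) (⊕-self α)) (⊕-identityʳ _))

      shift¹ : ∀ u v → (u ⊕ α) ⊕ v ≡ (u ⊕ v) ⊕ α
      shift¹ u v = trans (⊕-assoc u α v) (trans (cong (u ⊕_) (⊕-comm α v)) (sym (⊕-assoc u v α)))

      mixed : ∀ {u v} → Pa u ≡ false → Pa v ≡ false → Pb u ≡ true → Pb v ≡ false → Pa (u ⊕ v) ≡ true
      mixed {u} {v} u∉a v∉a u∈b v∉b = A.cancel α∈a (subst (λ z → Pa z ≡ true) (⊕-comm (u ⊕ v) α) (meet⊆ in-b in-c))
        where
        in-b : Pb ((u ⊕ v) ⊕ α) ≡ true
        in-b = subst (λ z → Pb z ≡ true) (sym (⊕-assoc u v α)) (B.⊕-closed u∈b (c⇒b v∉a (covered v∉a v∉b)))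
        in-c : Pc ((u ⊕ v) ⊕ α) ≡ true
        in-c = subst (λ z → Pc z ≡ true) (shift¹ u v) (C.⊕-closed (b⇒c u∉a u∈b) (covered v∉a v∉b))

    -- translation by α swaps the parts of the complement of Pa lying in Pb and in Pc
    complement-closed : ComplementClosed Pa
    complement-closed {u} {v} u∉a v∉a with Pb u in bu | Pb v in bv
    ... | true  | true  = meet⊆ (B.⊕-closed bu bv) (subst (λ z → Pc z ≡ true) (shift² u v) (C.⊕-closed (b⇒c u∉a bu) (b⇒c v∉a bv)))
    ... | false | false = meet⊆ (subst (λ z → Pb z ≡ true) (shift² u v) (B.⊕-closed (c⇒b u∉a (covered u∉a bu)) (c⇒b v∉a (covered v∉a bv))))
                                (C.⊕-closed (covered u∉a bu) (covered v∉a bv))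
    ... | true  | false = mixed u∉a v∉a bu bv
    ... | false | true  = trans (cong Pa (⊕-comm u v)) (mixed v∉a u∉a bv bu)

pencil : Fin 3 → Bool → Bool → Bool
pencil zero             x y = not x
pencil (suc zero)       x y = not y
pencil (suc (suc zero)) x y = not (x xor y)

record HyperplanePencil {q} (S : Fin 3 → V q → Bool) : Set where
  field
    ψ₁ ψ₂ : V q → Bool
    ψ₁-linear : Linear ψ₁
    ψ₂-linear : Linear ψ₂
    S≡pencil : ∀ i w → S i w ≡ pencil i (ψ₁ w) (ψ₂ w)
    α β : V q
    ψ₁α : ψ₁ α ≡ false
    ψ₂α : ψ₂ α ≡ true
    ψ₁β : ψ₁ β ≡ true
    ψ₂β : ψ₂ β ≡ false

NoCommonJump : ∀ {q} → (Fin 3 → V q → Bool) → Set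
NoCommonJump S = ∀ u → u ≢ 0v → ¬ (∀ i → Jumps (S i) u)

module Supports {q} {S : Fin 3 → V q → Bool} (S-0v : ∀ i → S i 0v ≡ true) (no-jump : NoCommonJump S) where

  private
    module Per (i : Fin 3) = Periods (S i)
    open Per using (isPeriod; isPeriod-subspace)

    P₀ P₁ P₂ : V q → Bool
    P₀ = isPeriod zero
    P₁ = isPeriod (suc zero)
    P₂ = isPeriod (suc (suc zero))

    cover : ∀ u → P₀ u ≡ false → P₁ u ≡ false → P₂ u ≡ false → ⊥
    cover u u∉₀ u∉₁ u∉₂ = no-jump u (IsSubspace.∉⇒≢0v (isPeriod-subspace zero) u∉₀) λ
      { zero → Per.nonPeriod⇒Jumps zero u∉₀
      ; (suc zero) → Per.nonPeriod⇒Jumps (suc zero) u∉₁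
      ; (suc (suc zero)) → Per.nonPeriod⇒Jumps (suc (suc zero)) u∉₂ }

    module T₀ = ThreeSubspaces (isPeriod-subspace zero) (isPeriod-subspace (suc zero)) (isPeriod-subspace (suc (suc zero))) cover
    module T₁ = ThreeSubspaces (isPeriod-subspace (suc zero)) (isPeriod-subspace zero) (isPeriod-subspace (suc (suc zero)))
                  (λ u a b c → cover u b a c)
    module T₂ = ThreeSubspaces (isPeriod-subspace (suc (suc zero))) (isPeriod-subspace zero) (isPeriod-subspace (suc zero))
                  (λ u a b c → cover u b c a)

    proper : ∀ i → (∀ w → S i w ≡ true) ⊎ Σ (V q) (λ n → isPeriod i n ≡ false)
    proper i with anySubset? (λ u → isPeriod i u Bool.≟ false)
    ... | yes n   = inj₂ n
    ... | no none = inj₁ λ w → Per.period-value i (S-0v i) (¬-not λ w∉ → none (w , w∉))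

    pencilOf : ∀ {n₀ n₁ n₂} → P₀ n₀ ≡ false → P₁ n₁ ≡ false → P₂ n₂ ≡ false → HyperplanePencil S
    pencilOf n₀∉ n₁∉ n₂∉ = pencil-from (T₀.outside-others n₁∉ n₂∉) (T₁.outside-others n₀∉ n₂∉) (T₂.outside-others n₀∉ n₁∉)
      where
      pencil-from : Σ (V q) (λ α → P₀ α ≡ true × P₁ α ≡ false × P₂ α ≡ false) →
                    Σ (V q) (λ β → P₁ β ≡ true × P₀ β ≡ false × P₂ β ≡ false) →
                    Σ (V q) (λ γ → P₂ γ ≡ true × P₀ γ ≡ false × P₁ γ ≡ false) → HyperplanePencil S
      pencil-from (α , α∈₀ , α∉₁ , α∉₂) (β , β∈₁ , β∉₀ , β∉₂) (γ , γ∈₂ , γ∉₀ , γ∉₁) = record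
        { ψ₁ = not ∘ P₀ ; ψ₂ = not ∘ P₁
        ; ψ₁-linear = hyperplane⇒linear (isPeriod-subspace zero) closed₀
        ; ψ₂-linear = hyperplane⇒linear (isPeriod-subspace (suc zero)) closed₁
        ; S≡pencil = S≡pencil
        ; α = α ; β = β
        ; ψ₁α = cong not α∈₀ ; ψ₂α = cong not α∉₁ ; ψ₁β = cong not β∉₀ ; ψ₂β = cong not β∈₁
        }
        where
        closed₀ : ComplementClosed P₀
        closed₀ = T₀.complement-closed α∈₀ α∉₁ α∉₂
        closed₁ : ComplementClosed P₁
        closed₁ = T₁.complement-closed β∈₁ β∉₀ β∉₂
        closed₂ : ComplementClosed P₂
        closed₂ = T₂.complement-closed γ∈₂ γ∉₀ γ∉₁
        P₂≡pencil : ∀ w → P₂ w ≡ not (not (P₀ w) xor not (P₁ w))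
        P₂≡pencil w with P₀ w in w₀ | P₁ w in w₁
        ... | true  | true  = T₂.meet⊆ γ∈₂ γ∉₀ γ∉₁ w₀ w₁
        ... | true  | false = ¬-not λ w∈₂ → contradiction (trans (sym w₁) (T₁.meet⊆ β∈₁ β∉₀ β∉₂ w₀ w∈₂)) λ ()
        ... | false | true  = ¬-not λ w∈₂ → contradiction (trans (sym w₀) (T₀.meet⊆ α∈₀ α∉₁ α∉₂ w₁ w∈₂)) λ ()
        ... | false | false = ¬-not (cover w w₀ w₁)
        S≡pencil : ∀ i w → S i w ≡ pencil i (not (P₀ w)) (not (P₁ w))
        S≡pencil zero w =
          trans (Per.support≡periods zero (S-0v zero) closed₀ n₀∉ w) (sym (Bool.not-involutive _))
        S≡pencil (suc zero) w =
          trans (Per.support≡periods (suc zero) (S-0v (suc zero)) closed₁ n₁∉ w) (sym (Bool.not-involutive _))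
        S≡pencil (suc (suc zero)) w =
          trans (Per.support≡periods (suc (suc zero)) (S-0v (suc (suc zero))) closed₂ n₂∉ w) (P₂≡pencil w)

  trichotomy : Σ (Fin 3) (λ i → ∀ w → S i w ≡ true) ⊎ HyperplanePencil S
  trichotomy with proper zero | proper (suc zero) | proper (suc (suc zero))
  ... | inj₁ full | _         | _         = inj₁ (zero , full)
  ... | inj₂ _    | inj₁ full | _         = inj₁ (suc zero , full)
  ... | inj₂ _    | inj₂ _    | inj₁ full = inj₁ (suc (suc zero) , full)
  ... | inj₂ (_ , n₀∉) | inj₂ (_ , n₁∉) | inj₂ (_ , n₂∉) = inj₂ (pencilOf n₀∉ n₁∉ n₂∉)

-- Coset coordinates

-- M in the coordinates (e₁, e₂, e₃, t, w) of p₁, p₂, p₃, f₀, f₁, …, f_q: the eᵢ pick the coset, (t, w) is the part in F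
cosetForm : ∀ {q} → (Fin 3 → V q → Bool) → V (3 + suc q) → Bool
cosetForm S (false ∷ false ∷ false ∷ t ∷ w) = t
cosetForm S (true  ∷ false ∷ false ∷ t ∷ w) = not t ∧ S zero w
cosetForm S (false ∷ true  ∷ false ∷ t ∷ w) = not t ∧ S (suc zero) w
cosetForm S (false ∷ false ∷ true  ∷ t ∷ w) = not t ∧ S (suc (suc zero)) w
cosetForm S _                               = false

cosetForm-⁅⁆ : ∀ {q} (S : Fin 3 → V q → Bool) i t w → cosetForm S (⁅ i ⁆ ++ t ∷ w) ≡ not t ∧ S i w
cosetForm-⁅⁆ S zero             t w = refl
cosetForm-⁅⁆ S (suc zero)       t w = refl
cosetForm-⁅⁆ S (suc (suc zero)) t w = refl

I5-free⇒noCommonJump : ∀ {q} {N : Matroid (3 + suc q)} {S : Fin 3 → V q → Bool} →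
  (∀ {G} → LinInd G → ¬ (pull N G ≈ᴹ I 5)) → N ≈ᴹ cosetForm S → NoCommonJump S
I5-free⇒noCommonJump {q} {N} {S} I5-free N≈ u u≢0 jumps = no-I₅ (jumps zero) (jumps (suc zero)) (jumps (suc (suc zero)))
  where
  no-I₅ : Jumps (S zero) u → Jumps (S (suc zero)) u → Jumps (S (suc (suc zero))) u → ⊥
  no-I₅ (s₁ , a₁ , b₁) (s₂ , a₂ , b₂) (s₃ , a₃ , b₃) = I5-free liG λ c c≢0 →
    trans (N≈ _ (LinInd-nonzero liG c≢0)) (table c c≢0)
    where
    shift : ∀ s → 0v ⊕ (u ⊕ (s ⊕ 0v)) ≡ s ⊕ u
    shift s = trans (⊕-identityˡ _) (trans (cong (u ⊕_) (⊕-identityʳ s)) (⊕-comm u s))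
    -- the I₅: f₀, f₀ + u and, in each coset, the point with w = sᵢ
    H : Vec (V 4) 5
    H = (false ∷ false ∷ false ∷ true ∷ []) ∷ (false ∷ false ∷ false ∷ true ∷ []) ∷ (true ∷ false ∷ false ∷ false ∷ [])
      ∷ (false ∷ true ∷ false ∷ false ∷ []) ∷ (false ∷ false ∷ true ∷ false ∷ []) ∷ []
    G : Vec (V (3 + suc q)) 5
    G = zipWith _++_ H (0v ∷ u ∷ s₁ ∷ s₂ ∷ s₃ ∷ [])
    heads : ∀ c → lincomb c H ≡ 0v → c ≡ 0v ⊎ c ≡ true ∷ true ∷ 0v
    heads = toWitness {a? = ∀? λ c → (lincomb c H ≟v 0v) →-dec ((c ≟v 0v) ⊎-dec (c ≟v (true ∷ true ∷ 0v)))} _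
    liG : LinInd G
    liG c e with heads c (++-injectiveˡ (lincomb c H) 0v (trans (sym (lincomb-zipWith-++ c H _)) e))
    ... | inj₁ c≡0 = c≡0
    ... | inj₂ refl = ⊥-elim (u≢0 (trans (sym (trans (⊕-identityˡ _) (⊕-identityʳ u)))
                                         (++-injectiveʳ (false ∷ false ∷ false ∷ false ∷ []) _ e)))
    table : ∀ c → c ≢ 0v → cosetForm S (lincomb c G) ≡ I 5 c
    table (false ∷ false ∷ false ∷ false ∷ false ∷ []) c≢0 = ⊥-elim (c≢0 refl)
    table (false ∷ false ∷ false ∷ false ∷ true  ∷ []) _ = trans (cong (S (suc (suc zero))) (⊕-identityʳ s₃)) a₃
    table (false ∷ false ∷ false ∷ true  ∷ false ∷ []) _ = trans (cong (S (suc zero)) (⊕-identityʳ s₂)) a₂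
    table (false ∷ false ∷ false ∷ true  ∷ true  ∷ []) _ = refl
    table (false ∷ false ∷ true  ∷ false ∷ false ∷ []) _ = trans (cong (S zero) (⊕-identityʳ s₁)) a₁
    table (false ∷ false ∷ true  ∷ false ∷ true  ∷ []) _ = refl
    table (false ∷ false ∷ true  ∷ true  ∷ false ∷ []) _ = refl
    table (false ∷ false ∷ true  ∷ true  ∷ true  ∷ []) _ = refl
    table (false ∷ true  ∷ false ∷ false ∷ false ∷ []) _ = refl
    table (false ∷ true  ∷ false ∷ false ∷ true  ∷ []) _ = refl
    table (false ∷ true  ∷ false ∷ true  ∷ false ∷ []) _ = refl
    table (false ∷ true  ∷ false ∷ true  ∷ true  ∷ []) _ = refl
    table (false ∷ true  ∷ true  ∷ false ∷ false ∷ []) _ = refl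
    table (false ∷ true  ∷ true  ∷ false ∷ true  ∷ []) _ = refl
    table (false ∷ true  ∷ true  ∷ true  ∷ false ∷ []) _ = refl
    table (false ∷ true  ∷ true  ∷ true  ∷ true  ∷ []) _ = refl
    table (true  ∷ false ∷ false ∷ false ∷ false ∷ []) _ = refl
    table (true  ∷ false ∷ false ∷ false ∷ true  ∷ []) _ = refl
    table (true  ∷ false ∷ false ∷ true  ∷ false ∷ []) _ = refl
    table (true  ∷ false ∷ false ∷ true  ∷ true  ∷ []) _ = refl
    table (true  ∷ false ∷ true  ∷ false ∷ false ∷ []) _ = refl
    table (true  ∷ false ∷ true  ∷ false ∷ true  ∷ []) _ = refl
    table (true  ∷ false ∷ true  ∷ true  ∷ false ∷ []) _ = refl
    table (true  ∷ false ∷ true  ∷ true  ∷ true  ∷ []) _ = refl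
    table (true  ∷ true  ∷ false ∷ false ∷ false ∷ []) _ = refl
    table (true  ∷ true  ∷ false ∷ false ∷ true  ∷ []) _ = trans (cong (S (suc (suc zero))) (shift s₃)) b₃
    table (true  ∷ true  ∷ false ∷ true  ∷ false ∷ []) _ = trans (cong (S (suc zero)) (shift s₂)) b₂
    table (true  ∷ true  ∷ false ∷ true  ∷ true  ∷ []) _ = refl
    table (true  ∷ true  ∷ true  ∷ false ∷ false ∷ []) _ = trans (cong (S zero) (shift s₁)) b₁
    table (true  ∷ true  ∷ true  ∷ false ∷ true  ∷ []) _ = refl
    table (true  ∷ true  ∷ true  ∷ true  ∷ false ∷ []) _ = refl
    table (true  ∷ true  ∷ true  ∷ true  ∷ true  ∷ []) _ = refl

-- The doubled kite

isZero-sound : ∀ {n} {x : V n} → isZero x ≡ true → x ≡ 0v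
isZero-sound {x = []}        _ = refl
isZero-sound {x = false ∷ x} e = cong (false ∷_) (isZero-sound e)

isZero-++ : ∀ {k l} (a : V k) (b : V l) → isZero (a ++ b) ≡ isZero a ∧ isZero b
isZero-++ []          b = refl
isZero-++ (true  ∷ a) b = refl
isZero-++ (false ∷ a) b = isZero-++ a b

Dpow-++ : ∀ {m} k {N : Matroid m} → N 0v ≡ false → ∀ (c : V k) x → Dpow k N (c ++ x) ≡ N x
Dpow-++ zero    N0 []      x = refl
Dpow-++ (suc k) {N} N0 (_ ∷ c) x = trans (cong (not (isZero (c ++ x)) ∧_) (Dpow-++ k N0 c x)) doubled
  where
  doubled : not (isZero (c ++ x)) ∧ N x ≡ N x
  doubled with N x in Nx
  ... | false = ∧-zeroʳ _
  ... | true  = cong (λ z → not z ∧ true) (trans (isZero-++ c x) (trans (cong (isZero c ∧_) x-nonzero) (∧-zeroʳ _)))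
    where
    x-nonzero : isZero x ≡ false
    x-nonzero = ¬-not λ x-zero → contradiction (trans (sym Nx) (trans (cong N (isZero-sound x-zero)) N0)) λ ()

-- the kite's x₁, …, x₆ in the coordinates (e₁, e₂, e₃, t, ψ₁, ψ₂) of a hyperplane pencil
kiteCoordinates : Vec (V 6) 6
kiteCoordinates =
  (false ∷ false ∷ false ∷ true  ∷ false ∷ false ∷ []) ∷
  (false ∷ false ∷ false ∷ true  ∷ true  ∷ true  ∷ []) ∷
  (false ∷ false ∷ false ∷ true  ∷ true  ∷ false ∷ []) ∷
  (true  ∷ false ∷ false ∷ false ∷ false ∷ false ∷ []) ∷
  (false ∷ true  ∷ false ∷ false ∷ false ∷ false ∷ []) ∷
  (false ∷ false ∷ true  ∷ false ∷ false ∷ false ∷ []) ∷ []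

kiteForm : V 6 → Bool
kiteForm (e₁ ∷ e₂ ∷ e₃ ∷ t ∷ x ∷ y ∷ []) = cosetForm (λ i _ → pencil i x y) (e₁ ∷ e₂ ∷ e₃ ∷ t ∷ [])

kite-in-coordinates : ∀ c → kite c ≡ kiteForm (lincomb c kiteCoordinates)
kite-in-coordinates = toWitness {a? = ∀? λ c → kite c Bool.≟ kiteForm (lincomb c kiteCoordinates)} _

kiteCoordinates-LinInd : LinInd kiteCoordinates
kiteCoordinates-LinInd = toWitness {a? = ∀? λ c → (lincomb c kiteCoordinates ≟v 0v) →-dec (c ≟v 0v)} _

module _ {r} {S : Fin 3 → V (suc (suc r)) → Bool} (pencil-S : HyperplanePencil S) where
  open HyperplanePencil pencil-S

  private
    W : Set
    W = V (3 + suc (suc (suc r)))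

    π : W → V 6
    π (e₁ ∷ e₂ ∷ e₃ ∷ t ∷ w) = e₁ ∷ e₂ ∷ e₃ ∷ t ∷ ψ₁ w ∷ ψ₂ w ∷ []

    π-additive : Additive π
    π-additive (_ ∷ _ ∷ _ ∷ _ ∷ w) (_ ∷ _ ∷ _ ∷ _ ∷ w′) =
      cong₂ (λ a b → _ ∷ _ ∷ _ ∷ _ ∷ a ∷ b ∷ []) (xor-homo ψ₁-linear w w′) (xor-homo ψ₂-linear w w′)

    cosetForm-π : ∀ u → cosetForm S u ≡ kiteForm (π u)
    cosetForm-π (false ∷ false ∷ false ∷ t ∷ w) = refl
    cosetForm-π (true  ∷ false ∷ false ∷ t ∷ w) = cong (not t ∧_) (S≡pencil zero w)
    cosetForm-π (false ∷ true  ∷ false ∷ t ∷ w) = cong (not t ∧_) (S≡pencil (suc zero) w)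
    cosetForm-π (false ∷ false ∷ true  ∷ t ∷ w) = cong (not t ∧_) (S≡pencil (suc (suc zero)) w)
    cosetForm-π (true  ∷ true  ∷ _     ∷ t ∷ w) = refl
    cosetForm-π (true  ∷ false ∷ true  ∷ t ∷ w) = refl
    cosetForm-π (false ∷ true  ∷ true  ∷ t ∷ w) = refl

    embed : V 6 → W
    embed (e₁ ∷ e₂ ∷ e₃ ∷ t ∷ x ∷ y ∷ []) = e₁ ∷ e₂ ∷ e₃ ∷ t ∷ lincomb (x ∷ y ∷ []) (β ∷ α ∷ [])

    embed-additive : Additive embed
    embed-additive (_ ∷ _ ∷ _ ∷ _ ∷ x ∷ y ∷ []) (_ ∷ _ ∷ _ ∷ _ ∷ x′ ∷ y′ ∷ []) =
      cong (λ w → _ ∷ _ ∷ _ ∷ _ ∷ w) (lincomb-⊕ (x ∷ y ∷ []) (x′ ∷ y′ ∷ []) (β ∷ α ∷ []))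

    π∘embed : ∀ v → π (embed v) ≡ v
    π∘embed (e₁ ∷ e₂ ∷ e₃ ∷ t ∷ x ∷ y ∷ []) = cong₂ (λ a b → e₁ ∷ e₂ ∷ e₃ ∷ t ∷ a ∷ b ∷ [])
      (linear-transversal ψ₁-linear ψ₁β (ψ₁α ∷ []) x (y ∷ []))
      (trans (linear-∷ ψ₂-linear x (y ∷ []) β (α ∷ []))
             (cong₂ _xor_ (trans (cong (x ∧_) ψ₂β) (∧-zeroʳ x)) (linear-transversal ψ₂-linear ψ₂α [] y [])))

    pad : V (suc (suc r)) → W
    pad κ = false ∷ false ∷ false ∷ false ∷ κ

  pencil⇒doubledKite : ∀ {N : Matroid (3 + suc (suc (suc r)))} → N ≈ᴹ cosetForm S →
    Σ (Vec W (r + 6)) λ G → LinInd G × pull N G ≈ᴹ DoubledKite r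
  pencil⇒doubledKite {N} N≈ with κs , li-κs , ker₁ , ker₂ ← commonKernelBasis ψ₁-linear ψ₂-linear ψ₂α ψ₁β ψ₂β =
    G , liG , λ c c≢0 → value c (LinInd-nonzero liG c≢0)
    where
    K : Vec (V 6) 6
    K = kiteCoordinates
    G : Vec W (r + 6)
    G = map pad κs ++ map embed K
    lincomb-G : ∀ cκ cx → lincomb (cκ ++ cx) G ≡ pad (lincomb cκ κs) ⊕ embed (lincomb cx K)
    lincomb-G cκ cx = trans (lincomb-++ cκ cx _ _) (cong₂ _⊕_ (lincomb-map pad (λ _ _ → refl) cκ κs) (lincomb-map embed embed-additive cx K))
    π-G : ∀ cκ cx → π (lincomb (cκ ++ cx) G) ≡ lincomb cx K
    π-G cκ cx = begin
      π (lincomb (cκ ++ cx) G)                         ≡⟨ cong π (lincomb-G cκ cx) ⟩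
      π (pad (lincomb cκ κs) ⊕ embed (lincomb cx K))   ≡⟨ π-additive (pad (lincomb cκ κs)) (embed (lincomb cx K)) ⟩
      π (pad (lincomb cκ κs)) ⊕ π (embed (lincomb cx K)) ≡⟨ cong₂ _⊕_ π-pad (π∘embed (lincomb cx K)) ⟩
      0v ⊕ lincomb cx K                                ≡⟨ ⊕-identityˡ (lincomb cx K) ⟩
      lincomb cx K                                     ∎
      where
      open ≡-Reasoning
      π-pad : π (pad (lincomb cκ κs)) ≡ 0v
      π-pad = cong₂ (λ a b → false ∷ false ∷ false ∷ false ∷ a ∷ b ∷ [])
        (linear-kernel ψ₁-linear ker₁ cκ) (linear-kernel ψ₂-linear ker₂ cκ)
    lincomb-G-κ : ∀ cκ → lincomb (cκ ++ 0v) G ≡ pad (lincomb cκ κs)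
    lincomb-G-κ cκ = trans (lincomb-G cκ 0v)
      (trans (cong (pad (lincomb cκ κs) ⊕_) (additive-0v embed embed-additive)) (⊕-identityʳ (pad (lincomb cκ κs))))
    liG : LinInd G
    liG c e with splitAt r c
    ... | cκ , cx , refl with refl ← kiteCoordinates-LinInd cx (trans (sym (π-G cκ cx)) (trans (cong π e) (additive-0v π π-additive)))
      with refl ← li-κs cκ (cong (drop 4) (trans (sym (lincomb-G-κ cκ)) e)) = 0v++0v r
    value : ∀ c → lincomb c G ≢ 0v → pull N G c ≡ DoubledKite r c
    value c Gc≢0 with splitAt r c
    ... | cκ , cx , refl = begin
      N (lincomb (cκ ++ cx) G)              ≡⟨ N≈ _ Gc≢0 ⟩
      cosetForm S (lincomb (cκ ++ cx) G)    ≡⟨ cosetForm-π (lincomb (cκ ++ cx) G) ⟩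
      kiteForm (π (lincomb (cκ ++ cx) G))   ≡⟨ cong kiteForm (π-G cκ cx) ⟩
      kiteForm (lincomb cx K)               ≡⟨ kite-in-coordinates cx ⟨
      kite cx                               ≡⟨ Dpow-++ r refl cκ cx ⟨
      DoubledKite r (cκ ++ cx)              ∎
      where open ≡-Reasoning

module CosetCoordinates {n r} {M : Matroid n} (tf : TriangleFree M) {F : PointSet n} (F-flat : IsFlat F)
  {B : Vec (V n) (3 + r)} (B-basis : IsBasis F B) (B-value : ∀ t w → (t ∷ w) ≢ 0v → pull M B (t ∷ w) ≡ t)
  {a : Vec (V n) 3} (a-I₃ : ContrRestrIso M F a (I 3)) where

  open Equivalence

  private
    q : ℕ
    q = suc (suc r)

    I₃-⁅⁆ : ∀ i → I 3 ⁅ i ⁆ ≡ true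
    I₃-⁅⁆ zero             = refl
    I₃-⁅⁆ (suc zero)       = refl
    I₃-⁅⁆ (suc (suc zero)) = refl

    point : ∀ i → NonEmptyCoset M F (lookup a i)
    point i = subst (NonEmptyCoset M F) (lincomb-⁅⁆ a i) (from (proj₂ a-I₃ ⁅ i ⁆ (⁅⁆≢0v i)) (I₃-⁅⁆ i))

  p : Fin 3 → V n
  p i = proj₁ (point i)

  Bs : Vec (V n) (3 + suc q)
  Bs = tabulate p ++ B

  S : Fin 3 → V q → Bool
  S i w = pull M Bs (⁅ i ⁆ ++ false ∷ w)

  private
    p∈coset : ∀ i → Coset F (lookup a i) (p i)
    p∈coset i = proj₁ (proj₂ (point i))

    p∈E : ∀ i → Gr M (p i)
    p∈E i = proj₂ (proj₂ (point i))

    ps-coset : ∀ i → Coset F (lookup a i) (lookup (tabulate p) i)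
    ps-coset i = subst (Coset F (lookup a i)) (sym (lookup∘tabulate p i)) (p∈coset i)

    B-LinInd : LinInd B
    B-LinInd = proj₁ B-basis

    unit-coords : ∀ i tw → lincomb (⁅ i ⁆ ++ tw) Bs ≡ p i ⊕ lincomb tw B
    unit-coords i tw = trans (lincomb-++ ⁅ i ⁆ tw _ B) (cong (_⊕ lincomb tw B) (trans (lincomb-⁅⁆ _ i) (lookup∘tabulate p i)))

    unit-coords-0v : ∀ i → lincomb (⁅ i ⁆ ++ 0v) Bs ≡ p i
    unit-coords-0v i = trans (unit-coords i 0v) (trans (cong (p i ⊕_) (lincomb-0v B)) (⊕-identityʳ (p i)))

    coset-coords : ∀ e tw → Coset F (lincomb e a) (lincomb (e ++ tw) Bs)
    coset-coords e tw = subst (Coset F (lincomb e a)) (sym (lincomb-++ e tw _ B))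
      (Coset-⊕ F-flat (lincomb-Coset F-flat a (tabulate p) ps-coset e) (lincomb∈⟨⟩ B-basis tw))

  Bs-LinInd : LinInd Bs
  Bs-LinInd (e₁ ∷ e₂ ∷ e₃ ∷ tw) sum≡0
    with refl ← proj₁ a-I₃ (e₁ ∷ e₂ ∷ e₃ ∷ []) (Coset∋0v F-flat (subst (Coset F _) sum≡0 (coset-coords (e₁ ∷ e₂ ∷ e₃ ∷ []) tw)))
    = cong (λ tw → false ∷ false ∷ false ∷ tw) (B-LinInd tw sum≡0)

  S-0v : ∀ i → S i 0v ≡ true
  S-0v i = trans (cong M (unit-coords-0v i)) (proj₂ (p∈E i))

  private
    on-coset : ∀ i t w → (⁅ i ⁆ ++ t ∷ w) ≢ 0v → M (lincomb (⁅ i ⁆ ++ t ∷ w) Bs) ≡ cosetForm S (⁅ i ⁆ ++ t ∷ w)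
    on-coset i false w _   = sym (cosetForm-⁅⁆ S i false w)
    on-coset i true  w c≢0 = trans (¬-not triangle) (sym (cosetForm-⁅⁆ S i true w))
      where
      z∈E : Gr M (lincomb (true ∷ w) B)
      z∈E = LinInd-nonzero B-LinInd {true ∷ w} (λ ()) , B-value true w (λ ())
      triangle : M (lincomb (⁅ i ⁆ ++ true ∷ w) Bs) ≢ true
      triangle Mx = TriangleFree⇒sum∉E tf (p∈E i) z∈E (subst (Gr M) (unit-coords i (true ∷ w)) (LinInd-nonzero Bs-LinInd c≢0 , Mx))
    off-cosets : ∀ e tw → e ≢ 0v → I 3 e ≡ false → (e ++ tw) ≢ 0v → M (lincomb (e ++ tw) Bs) ≡ false
    off-cosets e tw e≢0 I₃e c≢0 = ¬-not λ Mx →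
      contradiction (trans (sym I₃e) (to (proj₂ a-I₃ e e≢0) (_ , coset-coords e tw , LinInd-nonzero Bs-LinInd c≢0 , Mx))) λ ()

  pull≈cosetForm : pull M Bs ≈ᴹ cosetForm S
  pull≈cosetForm (false ∷ false ∷ false ∷ t ∷ w) c≢0 = B-value t w (c≢0 ∘ cong (λ tw → false ∷ false ∷ false ∷ tw))
  pull≈cosetForm (true  ∷ false ∷ false ∷ t ∷ w) c≢0 = on-coset zero             t w c≢0
  pull≈cosetForm (false ∷ true  ∷ false ∷ t ∷ w) c≢0 = on-coset (suc zero)       t w c≢0
  pull≈cosetForm (false ∷ false ∷ true  ∷ t ∷ w) c≢0 = on-coset (suc (suc zero)) t w c≢0
  pull≈cosetForm (true  ∷ true  ∷ e₃    ∷ tw)    c≢0 = off-cosets (true ∷ true ∷ e₃ ∷ []) tw (λ ()) refl c≢0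
  pull≈cosetForm (true  ∷ false ∷ true  ∷ tw)    c≢0 = off-cosets (true ∷ false ∷ true ∷ []) tw (λ ()) refl c≢0
  pull≈cosetForm (false ∷ true  ∷ true  ∷ tw)    c≢0 = off-cosets (false ∷ true ∷ true ∷ []) tw (λ ()) refl c≢0

  private
    F⊆Bs : ∀ {f} → ⟨ F ⟩ f → InSpan Bs f
    F⊆Bs f∈F = InSpan-++ʳ (tabulate p) (⟨F⟩⊆span B-basis f∈F)

    p∈Bs : ∀ i → InSpan Bs (p i)
    p∈Bs i = ⁅ i ⁆ ++ 0v , unit-coords-0v i

  X₃ : PointSet n
  X₃ = F ∪ (Coset F (lookup a zero) ∪ Coset F (lookup a (suc zero)) ∪ Coset F (lookup a (suc (suc zero))))

  Cl-basis : IsBasis (Cl X₃) Bs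
  Cl-basis = Bs-LinInd , Cl-spanned X⊆Bs Bs⊆X
    where
    X⊆Bs : ∀ {z} → X₃ z → InSpan Bs z
    X⊆Bs (inj₁ z∈F)                 = F⊆Bs (inj₂ z∈F)
    X⊆Bs (inj₂ (inj₁ z∈A))          = Coset⊆span F-flat F⊆Bs (p∈coset zero) (p∈Bs zero) z∈A
    X⊆Bs (inj₂ (inj₂ (inj₁ z∈A)))   = Coset⊆span F-flat F⊆Bs (p∈coset (suc zero)) (p∈Bs (suc zero)) z∈A
    X⊆Bs (inj₂ (inj₂ (inj₂ z∈A)))   = Coset⊆span F-flat F⊆Bs (p∈coset (suc (suc zero))) (p∈Bs (suc (suc zero))) z∈A
    Bs⊆X : All X₃ Bs
    Bs⊆X = inj₂ (inj₁ (p∈coset zero)) ∷ inj₂ (inj₂ (inj₁ (p∈coset (suc zero)))) ∷ inj₂ (inj₂ (inj₂ (p∈coset (suc (suc zero)))))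
         ∷ All.map inj₁ (basis⊆ B-basis)

  affine-case : ∀ i → (∀ w → S i w ≡ true) → IsAffine M (Cl (F ∪ Coset F (lookup a i)))
  affine-case i full = IsAffine-xor (liᵢ , Cl-spanned Xᵢ⊆Bᵢ (inj₂ (p∈coset i) ∷ All.map inj₁ (basis⊆ B-basis))) value
    where
    Bᵢ : Vec (V n) (suc (suc q))
    Bᵢ = p i ∷ B
    coords : ∀ e tw → lincomb (e ∷ tw) Bᵢ ≡ lincomb (scale e ⁅ i ⁆ ++ tw) Bs
    coords true  tw = sym (unit-coords i tw)
    coords false tw = sym (trans (lincomb-++ (0v {3}) tw (tabulate p) B) (trans (cong (_⊕ lincomb tw B) (lincomb-0v (tabulate p))) (⊕-identityˡ _)))
    liᵢ : LinInd Bᵢ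
    liᵢ (false ∷ tw) sum≡0 = cong (false ∷_) (B-LinInd tw sum≡0)
    liᵢ (true  ∷ tw) sum≡0 = ⊥-elim (⁅⁆≢0v i (++-injectiveˡ ⁅ i ⁆ 0v (Bs-LinInd _ (trans (sym (coords true tw)) sum≡0))))
    Xᵢ⊆Bᵢ : ∀ {z} → (F ∪ Coset F (lookup a i)) z → InSpan Bᵢ z
    Xᵢ⊆Bᵢ (inj₁ z∈F) = InSpan-∷ (p i) (⟨F⟩⊆span B-basis (inj₂ z∈F))
    Xᵢ⊆Bᵢ (inj₂ z∈A) = Coset⊆span F-flat (InSpan-∷ (p i) ∘ ⟨F⟩⊆span B-basis) (p∈coset i) (InSpan-lookup Bᵢ zero) z∈A
    form : ∀ e t w → cosetForm S (scale e ⁅ i ⁆ ++ t ∷ w) ≡ e xor t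
    form false t w = refl
    form true  t w = trans (cosetForm-⁅⁆ S i t w) (trans (cong (not t ∧_) (full w)) (∧-identityʳ _))
    value : ∀ e t w → (e ∷ t ∷ w) ≢ 0v → pull M Bᵢ (e ∷ t ∷ w) ≡ e xor t
    value e t w c≢0 = trans (cong M (coords e (t ∷ w))) (trans (pull≈cosetForm _ coeffs≢0) (form e t w))
      where
      coeffs≢0 : scale e ⁅ i ⁆ ++ t ∷ w ≢ 0v
      coeffs≢0 eq = LinInd-nonzero liᵢ c≢0 (trans (coords e (t ∷ w)) (trans (cong (λ c → lincomb c Bs) eq) (lincomb-0v Bs)))

  dichotomy : Free M (I 5) →
    Σ (Fin 3) (λ i → IsAffine M (Cl (F ∪ Coset F (lookup a i)))) ⊎ IsoRestr M (Cl X₃) (DoubledKite r)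
  dichotomy I5-free with Supports.trichotomy S-0v (I5-free⇒noCommonJump (Free⇒pull {M = M} I5-free Bs-LinInd) pull≈cosetForm)
  ... | inj₁ (i , full) = inj₁ (i , affine-case i full)
  ... | inj₂ pencil-S with G , liG , G-value ← pencil⇒doubledKite pencil-S pull≈cosetForm =
    inj₂ (IsoRestr-reindex {M = M} Cl-basis (ℕ.+-comm r 6) G liG G-value)

lemma4p1 : ∀ {n} (M : Matroid n) → Free M (I 5) → TriangleFree M → Free M C5 →
    (F : PointSet n) → IsFlat F → (d : ℕ) → 3 ≤ d → HasDim F d → IsAffine M F →
    (a : Vec (V n) 3) → ContrRestrIso M F a (I 3) →
    Σ (Fin 3) (λ i → IsAffine M (Cl (F ∪ Coset F (lookup a i))))
    ⊎ IsoRestr M (Cl (F ∪ (Coset F (lookup a zero) ∪ Coset F (lookup a (suc zero))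
                            ∪ Coset F (lookup a (suc (suc zero))))))
        (DoubledKite (d ∸ 3))
lemma4p1 M I5-free tf _ F F-flat (suc (suc (suc r))) (s≤s (s≤s (s≤s z≤n))) F-dim aff a a-I₃
  with B , B-basis , B-value ← adaptedBasis tf F-flat F-dim aff =
  CosetCoordinates.dichotomy tf F-flat B-basis B-value a-I₃ I5-free
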